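{- Let $\widetilde{\Sigma}$ be a 2-stack call-return alphabet, $r\in\mathbb{N}$ and $S\in\mathit{Spheres}_r(\widetilde{\Sigma})$. There is a generalized Büchi 2NWA $\mathcal{B}$ over $\widetilde{\Sigma}$ such that $\mathcal{L}^\omega(\mathcal{B})=\{W\in\mathbb{NW}^\omega(\widetilde{\Sigma})\mid\text{there are infinitely many } i\in\mathbb{N}_+ \text{ with } r\text{ - }\mathrm{Sph}(W,i)\cong S\}$.
   Context: Let $\mathbb{N}_+=\{1,2,\dots\}$, $[n]=\{1,\dots,n\}$. A 2-stack call-return alphabet is $\widetilde{\Sigma}=\langle\{(\Sigma_c^1,\Sigma_r^1),(\Sigma_c^2,\Sigma_r^2)\},\Sigma_{int}\rangle$ of pairwise disjoint finite sets; $\Sigma_c=\Sigma_c^1\cup\Sigma_c^2$, $\Sigma_r=\Sigma_r^1\cup\Sigma_r^2$, $\Sigma=\Sigma_c\cup\Sigma_r\cup\Sigma_{int}$. A string is $s$-well formed if generated by $A::=aAb\mid AA\mid\varepsilon\mid c$, $a\in\Sigma_c^s$, $b\in\Sigma_r^s$, $c\in\Sigma\setminus(\Sigma_c^s\cup\Sigma_r^s)$. A (finite) nested word is $([n],\lessdot,\mu,\lambda)$, $n\ge1$, and an infinite nested word is $(\mathbb{N}_+,\lessdot,\mu,\lambda)$, where $\lessdot$ relates each position to the next, $\lambda$ maps positions to $\Sigma$, and $\mu=\mu^1\cup\mu^2$ with $(i,j)\in\mu^s$ iff $i<j$, $\lambda(i)\in\Sigma_c^s$, $\lambda(j)\in\Sigma_r^s$,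 $\lambda(i+1)\dots\lambda(j-1)$ $s$-well formed. $\mathbb{NW}(\widetilde{\Sigma})$, $\mathbb{NW}^\omega(\widetilde{\Sigma})$ denote the sets of finite, resp. infinite nested words. $\mu(i)=j$, $\mu^{ -1}(j)=i$ for $(i,j)\in\mu$. A generalized Büchi 2NWA over $\widetilde{\Sigma}$ is $\mathcal{B}=(Q,\delta,Q_I,F,C)$, finite $Q$, $Q_I,F,C\subseteq Q$, $\delta=\langle\delta_1,\delta_2\rangle$, $\delta_1\subseteq Q\times\Sigma\times Q$, $\delta_2\subseteq Q\times Q\times\Sigma_r\times Q$. A run on $(\mathbb{N}_+,\lessdot,\mu,\lambda)$ is $\rho:\mathbb{N}_+\to Q$ with $(q,\lambda(1),\rho(1))\in\delta_1$ for some $q\in Q_I$ and for $i\ge2$: $(\rho(\mu^{ -1}(i)),\rho(i-1),\lambda(i),\rho(i))\in\delta_2$ if $\lambda(i)\in\Sigma_r$ and $\mu^{ -1}(i)$ is defined, else $(\rho(i-1),\lambda(i),\rho(i))\in\delta_1$. Accepting if $\rho(i)\in F$ for infinitely many $i$ and, whenever $\rho(i)\in C$, $\lambda(i)\in\Sigma_c$ and $\mu(i)$ is defined. $\mathcal{L}^\omega(\mathcal{B})$ is the set of infinite nested words with an accepting run. $d_W(i,j)$ is the distance in the undirected graph on positions of $W$ with edge $\{i,j\}$ iff $(i,j)$ or $(j,i)$ is in $\lessdot\cup\mu$. $r\text{ - }\mathrm{Sph}(W,i)$ is the substructure induced on $\{j\mid d_W(i,j)\le r\}$ with distinguished center $i$;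 isomorphisms preserve $\lessdot,\mu,\lambda$, center. $\mathit{Spheres}_r(\widetilde{\Sigma})$ is the set of isomorphism types of $r\text{ - }\mathrm{Sph}(W,i)$ with $W\in\mathbb{NW}(\widetilde{\Sigma})$ and $i$ a node of $W$. -}

module Defs where

open import Data.Nat using (ℕ; zero; suc; _+_; _∸_; _<_; _≤_; _<?_)
open import Data.Fin using (Fin; toℕ; fromℕ<)
open import Data.Bool using (Bool; T)
open import Data.List using (List; []; _∷_; _++_; applyUpTo)
open import Data.Product using (Σ; ∃; _×_; _,_)
open import Data.Sum using (_⊎_)
open import Relation.Binary.PropositionalEquality using (_≡_; _≢_)
open import Relation.Nullary using (¬_; yes; no)
open import Function.Bundles using (_⇔_)

data Stack : Set where
  s₁ s₂ : Stack

data Kind : Set where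
  call : Stack → Kind
  ret  : Stack → Kind
  int  : Kind

-- A finite alphabet Σ = Fin size, partitioned by `kind` into the five
-- pairwise disjoint sets Σ_c^1, Σ_r^1, Σ_c^2, Σ_r^2, Σ_int.
record Alphabet : Set where
  field
    size : ℕ
    kind : Fin size → Kind

  Sym : Set
  Sym = Fin size

open Alphabet public

module _ (A : Alphabet) where

  data WellFormed (s : Stack) : List (Sym A) → Set where
    nest  : ∀ {a b w} → kind A a ≡ call s → kind A b ≡ ret s →
            WellFormed s w → WellFormed s (a ∷ w ++ b ∷ [])
    cat   : ∀ {u v} → WellFormed s u → WellFormed s v → WellFormed s (u ++ v)
    eps   : WellFormed s []
    other : ∀ {c} → kind A c ≢ call s → kind A c ≢ ret s → WellFormed s (c ∷ [])

  between : (ℕ → Sym A) → ℕ → ℕ → List (Sym A)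
  between g i j = applyUpTo (λ t → g (suc i + t)) (j ∸ suc i)

  MatchS : Stack → (ℕ → Sym A) → ℕ → ℕ → Set
  MatchS s g i j = i < j × kind A (g i) ≡ call s × kind A (g j) ≡ ret s
                   × WellFormed s (between g i j)

  Match : (ℕ → Sym A) → ℕ → ℕ → Set
  Match g i j = Σ Stack λ s → MatchS s g i j

  record Struct : Set₁ where
    field
      Pos   : Set
      lab   : Pos → Sym A
      next  : Pos → Pos → Set
      match : Pos → Pos → Set

  open Struct public

  -- Infinite nested word with labelling g.  Convention: Agda position p
  -- stands for the paper's position p+1 ∈ ℕ₊.
  infNW : (ℕ → Sym A) → Struct
  infNW g = record { Pos = ℕ ; lab = g
                   ; next = λ i j → j ≡ suc i
                   ; match = Match g }

  -- extension of a finite labelling to ℕ (values beyond the word are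
  -- never inspected by `Match` restricted to positions < length)
  extend : ∀ {m} → (Fin (suc m) → Sym A) → ℕ → Sym A
  extend {m} f k with k <? suc m
  ... | yes p = f (fromℕ< p)
  ... | no _  = f Fin.zero
    where import Data.Fin as Fin

  -- Finite nested word of length n = suc m ≥ 1; Agda position p ∈ Fin n
  -- stands for the paper's position p+1 ∈ [n].
  finNW : ∀ {m} → (Fin (suc m) → Sym A) → Struct
  finNW {m} f = record { Pos = Fin (suc m) ; lab = f
                       ; next = λ i j → toℕ j ≡ suc (toℕ i)
                       ; match = λ i j → Match (extend f) (toℕ i) (toℕ j) }

  Edge : (W : Struct) → Pos W → Pos W → Set
  Edge W j k = (next W j k ⊎ next W k j) ⊎ (match W j k ⊎ match W k j)

  -- Within W r j k  ⇔  d_W(j,k) ≤ r  (a walk of length ≤ r)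
  data Within (W : Struct) : ℕ → Pos W → Pos W → Set where
    here : ∀ {r j} → Within W r j j
    step : ∀ {r j k l} → Edge W j k → Within W r k l → Within W (suc r) j l

  -- r-Sph(W,i) ≅ r-Sph(W',i') : an isomorphism of the induced
  -- substructures on {j | d_W(i,j) ≤ r} and {j' | d_W'(i',j') ≤ r}
  -- preserving ⋖, μ, λ and the center.
  SphIso : ℕ → (W : Struct) → Pos W → (W' : Struct) → Pos W' → Set
  SphIso r W i W' i' =
    Σ (Pos W → Pos W') λ f → Σ (Pos W' → Pos W) λ g →
      (f i ≡ i')
    × (∀ j → Within W r i j → Within W' r i' (f j))
    × (∀ j' → Within W' r i' j' → Within W r i (g j'))
    × (∀ j → Within W r i j → g (f j) ≡ j)
    × (∀ j' → Within W' r i' j' → f (g j') ≡ j')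
    × (∀ j → Within W r i j → lab W' (f j) ≡ lab W j)
    × (∀ j k → Within W r i j → Within W r i k →
         (next W j k ⇔ next W' (f j) (f k)))
    × (∀ j k → Within W r i j → Within W r i k →
         (match W j k ⇔ match W' (f j) (f k)))

  record GBA : Set where
    field
      states : ℕ
      δ₁     : Fin states → Sym A → Fin states → Bool
      δ₂     : Fin states → Fin states → Sym A → Fin states → Bool
      QI     : Fin states → Bool
      F      : Fin states → Bool
      C      : Fin states → Bool

  open GBA public

  InfinitelyOften : (ℕ → Set) → Set
  InfinitelyOften P = ∀ m → Σ ℕ λ i → m ≤ i × P i

  IsRun : (B : GBA) → (g : ℕ → Sym A) → (ℕ → Fin (states B)) → Set
  IsRun B g ρ =
      (Σ (Fin (states B)) λ q → T (QI B q) × T (δ₁ B q (g 0) (ρ 0)))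
    × (∀ p → (∀ i → Match g i (suc p) →
                T (δ₂ B (ρ i) (ρ p) (g (suc p)) (ρ (suc p))))
           × ((∀ i → ¬ Match g i (suc p)) →
                T (δ₁ B (ρ p) (g (suc p)) (ρ (suc p)))))

  IsAccepting : (B : GBA) → (g : ℕ → Sym A) → (ℕ → Fin (states B)) → Set
  IsAccepting B g ρ =
      InfinitelyOften (λ i → T (F B (ρ i)))
    × (∀ i → T (C B (ρ i)) →
         (Σ Stack λ s → kind A (g i) ≡ call s) × (Σ ℕ λ j → Match g i j))

  Accepts : GBA → (ℕ → Sym A) → Set
  Accepts B g = Σ (ℕ → Fin (states B)) λ ρ → IsRun B g ρ × IsAccepting B g ρ

-- The automaton reads W guessing, at each position, which node of the ball
-- of radius r around v in V that position plays in the current copy of the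
-- sphere (or none), and remembers which nodes the current copy has used.
-- Transitions check the guesses locally against labels, successor and
-- matching edges (the latter through the state at the call), demanding that
-- nodes strictly inside the ball have all their neighbours guessed; a copy is
-- complete (a Büchi state) once every node has been used, and the next round
-- starts afresh.  Between two completions the guessed positions then form an
-- isomorphic copy of the sphere: no node is guessed twice, every node is
-- guessed, and a guessed matching edge cannot straddle a completion.
-- Conversely, a walk in W is determined by its start and its directions, so
-- only boundedly many positions lie within distance r + 1 of an initial
-- segment; hence among infinitely many copies one can choose copies lying in
-- disjoint blocks that no matching edge enters from the left, and guess them
-- block by block.

module Submission where

open import Defs
open import Data.Nat using (ℕ; zero; suc; _+_; _*_; _∸_; _<_; _≤_; _<?_; _≤?_; z≤n; s≤s; pred; _≟_; >-nonZero)
open import Data.Nat.Properties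
open import Data.Nat.Induction using (<-wellFounded)
open import Induction.WellFounded using (Acc; acc)
open import Data.Fin using (Fin; toℕ; fromℕ<; combine; remQuot) renaming (_≟_ to _≟ᶠ_; _<_ to _<ᶠ_)
open import Data.Fin.Properties using (any?; all?; toℕ-injective; toℕ-fromℕ<; remQuot-combine; pigeonhole)
open import Data.Bool using (Bool; true; false; T)
import Data.Bool.Properties as Bool
open import Data.Vec using (Vec; []; _∷_; lookup; replicate; tabulate; _[_]≔_)
import Data.Vec.Properties as Vec
open import Data.List using (List; []; _∷_; _++_; applyUpTo; filter; allFin)
open import Data.List.Properties using (++-assoc)
open import Data.List.Membership.Propositional.Properties using (∈-filter⁺; ∈-allFin)
open import Data.List.Relation.Unary.All using () renaming (lookup to lookupᴬ)
open import Data.List.Relation.Unary.All.Properties using (all-filter)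
open import Data.List.Extrema ≤-totalOrder using (argmax; argmax-all; f[xs]≤f[argmax])
open import Data.Maybe using (Maybe; just; nothing; _>>=_)
import Data.Maybe.Properties as Maybe
open import Data.Product using (Σ; _×_; _,_; proj₁; proj₂)
open import Data.Sum using (_⊎_; inj₁; inj₂; [_,_])
open import Data.Unit using (⊤; tt)
open import Data.Empty using (⊥; ⊥-elim)
open import Function using (case_of_)
open import Function.Bundles using (_⇔_; mk⇔; Equivalence)
open import Relation.Binary.PropositionalEquality hiding ([_])
open import Relation.Binary using (tri<; tri≈; tri>)
open import Relation.Unary using (Decidable)
open import Relation.Nullary using (¬_; Dec; yes; no; does; contradiction)
open import Relation.Nullary.Decidable
  using (map′; _×-dec_; _⊎-dec_; ¬?; _→-dec_; isYes; True; toWitness; fromWitness; decidable-stable; dec-true; dec-false; does-⇔)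

-- Well-formed words and matchings

_≟ˢ_ : (s t : Stack) → Dec (s ≡ t)
s₁ ≟ˢ s₁ = yes refl
s₁ ≟ˢ s₂ = no λ ()
s₂ ≟ˢ s₁ = no λ ()
s₂ ≟ˢ s₂ = yes refl

call-injective : ∀ {s t} → call s ≡ call t → s ≡ t
call-injective refl = refl

ret-injective : ∀ {s t} → ret s ≡ ret t → s ≡ t
ret-injective refl = refl

_≟ᵏ_ : (a b : Kind) → Dec (a ≡ b)
call s ≟ᵏ call t = map′ (cong call) call-injective (s ≟ˢ t)
ret s  ≟ᵏ ret t  = map′ (cong ret) ret-injective (s ≟ˢ t)
int    ≟ᵏ int    = yes refl
call _ ≟ᵏ ret _  = no λ ()
call _ ≟ᵏ int    = no λ ()
ret _  ≟ᵏ call _ = no λ ()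
ret _  ≟ᵏ int    = no λ ()
int    ≟ᵏ call _ = no λ ()
int    ≟ᵏ ret _  = no λ ()

applyUpTo-cong : ∀ {X : Set} {f h : ℕ → X} → (∀ t → f t ≡ h t) → ∀ n → applyUpTo f n ≡ applyUpTo h n
applyUpTo-cong e zero    = refl
applyUpTo-cong e (suc n) = cong₂ _∷_ (e 0) (applyUpTo-cong (λ t → e (suc t)) n)

applyUpTo-+ : ∀ {X : Set} (f : ℕ → X) a b →
  applyUpTo f (a + suc b) ≡ applyUpTo f a ++ f a ∷ applyUpTo (λ t → f (suc a + t)) b
applyUpTo-+ f zero    b = refl
applyUpTo-+ f (suc a) b = cong (f 0 ∷_) (applyUpTo-+ (λ t → f (suc t)) a b)

pop : ℕ → Maybe ℕ
pop zero    = nothing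
pop (suc h) = just h

module _ (A : Alphabet) where

  heightStep : Stack → Kind → ℕ → Maybe ℕ
  heightStep s k h with k ≟ᵏ call s | k ≟ᵏ ret s
  ... | yes _ | _     = just (suc h)
  ... | no _  | yes _ = pop h
  ... | no _  | no _  = just h

  height : Stack → ℕ → List (Sym A) → Maybe ℕ
  height s h []      = just h
  height s h (c ∷ w) = heightStep s (kind A c) h >>= λ h′ → height s h′ w

  height-++ : ∀ s h u v → height s h (u ++ v) ≡ (height s h u >>= λ h′ → height s h′ v)
  height-++ s h []      v = refl
  height-++ s h (c ∷ u) v with heightStep s (kind A c) h
  ... | nothing = refl
  ... | just h′ = height-++ s h′ u v

  heightStep-call : ∀ {s k} h → k ≡ call s → heightStep s k h ≡ just (suc h)
  heightStep-call {s} h refl with call s ≟ᵏ call s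
  ... | yes _ = refl
  ... | no ≢ = contradiction refl ≢

  heightStep-ret : ∀ {s k} h → k ≡ ret s → heightStep s k h ≡ pop h
  heightStep-ret {s} h refl with ret s ≟ᵏ call s | ret s ≟ᵏ ret s
  ... | no _ | yes _ = refl
  ... | no _ | no ≢ = contradiction refl ≢

  heightStep-other : ∀ {s k} h → k ≢ call s → k ≢ ret s → heightStep s k h ≡ just h
  heightStep-other {s} {k} h ≢c ≢r with k ≟ᵏ call s | k ≟ᵏ ret s
  ... | yes e | _     = contradiction e ≢c
  ... | no _  | yes e = contradiction e ≢r
  ... | no _  | no _  = refl

  wellFormed⇒height : ∀ {s w} → WellFormed A s w → ∀ h → height s h w ≡ just h
  wellFormed⇒height {s} (nest {a} {b} {w} ka kb wf) h
    rewrite heightStep-call h ka | height-++ s (suc h) w (b ∷ []) | wellFormed⇒height wf (suc h)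
          | heightStep-ret (suc h) kb = refl
  wellFormed⇒height {s} (cat {u} {v} wu wv) h
    rewrite height-++ s h u v | wellFormed⇒height wu h = wellFormed⇒height wv h
  wellFormed⇒height eps h = refl
  wellFormed⇒height (other ≢c ≢r) h rewrite heightStep-other h ≢c ≢r = refl

  Closes : Stack → ℕ → List (Sym A) → Set
  Closes s zero    w = WellFormed A s w
  Closes s (suc k) w = Σ (List (Sym A)) λ u → Σ (Sym A) λ b → Σ (List (Sym A)) λ w′ →
                         w ≡ u ++ b ∷ w′ × WellFormed A s u × kind A b ≡ ret s × Closes s k w′

  Closes-++ : ∀ {s} k {u w} → WellFormed A s u → Closes s k w → Closes s k (u ++ w)
  Closes-++ zero    wu cw = cat wu cw
  Closes-++ (suc k) {u} wu (u′ , b , w′ , refl , wu′ , kb , cw′) =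
    u ++ u′ , b , w′ , sym (++-assoc u u′ (b ∷ w′)) , cat wu wu′ , kb , cw′

  height⇒closes : ∀ s w h → height s h w ≡ just 0 → Closes s h w
  height⇒closes s [] h refl = eps
  height⇒closes s (c ∷ w) h eq with kind A c ≟ᵏ call s | kind A c ≟ᵏ ret s
  ... | yes kc | _ with height⇒closes s w (suc h) eq
  ...   | u , b , w′ , refl , wu , kb , cw =
          subst (Closes s h) (cong (c ∷_) (++-assoc u (b ∷ []) w′))
                (Closes-++ h (nest kc kb wu) cw)
  height⇒closes s (c ∷ w) zero    () | no _ | yes _
  height⇒closes s (c ∷ w) (suc h) eq | no _ | yes kr = [] , c , w , refl , eps , kr , height⇒closes s w h eq
  height⇒closes s (c ∷ w) h eq | no ≢c | no ≢r = Closes-++ h (other ≢c ≢r) (height⇒closes s w h eq)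

  wellFormed? : ∀ s w → Dec (WellFormed A s w)
  wellFormed? s w = map′ (height⇒closes s w 0) (λ wf → wellFormed⇒height wf 0)
                         (Maybe.≡-dec _≟_ (height s 0 w) (just 0))

  match? : ∀ g i j → Dec (Match A g i j)
  match? g i j = map′ fromSum toSum (matchS? s₁ ⊎-dec matchS? s₂)
    where
      matchS? : ∀ s → Dec (MatchS A s g i j)
      matchS? s = (i <? j) ×-dec (kind A (g i) ≟ᵏ call s) ×-dec (kind A (g j) ≟ᵏ ret s)
                  ×-dec wellFormed? s (between A g i j)
      fromSum : MatchS A s₁ g i j ⊎ MatchS A s₂ g i j → Match A g i j
      fromSum (inj₁ m) = s₁ , m
      fromSum (inj₂ m) = s₂ , m
      toSum : Match A g i j → MatchS A s₁ g i j ⊎ MatchS A s₂ g i j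
      toSum (s₁ , m) = inj₁ m
      toSum (s₂ , m) = inj₂ m

  between-split : ∀ g i k j → i < k → k < j → between A g i j ≡ between A g i k ++ g k ∷ between A g k j
  between-split g i k j i<k k<j = begin
    applyUpTo f (j ∸ suc i)                                 ≡⟨ cong (applyUpTo f) j-i≡a+1+b ⟩
    applyUpTo f (a + suc b)                                 ≡⟨ applyUpTo-+ f a b ⟩
    applyUpTo f a ++ f a ∷ applyUpTo (λ t → f (suc a + t)) b ≡⟨ cong₂ (λ x l → applyUpTo f a ++ x ∷ l)
                                                                     (cong g i+1+a≡k) (applyUpTo-cong shift b) ⟩
    applyUpTo f a ++ g k ∷ applyUpTo (λ t → g (suc k + t)) b ∎
    where
      open ≡-Reasoning
      f : ℕ → Sym A
      f t = g (suc i + t)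
      a = k ∸ suc i
      b = j ∸ suc k
      i+1+a≡k : suc i + a ≡ k
      i+1+a≡k = m+[n∸m]≡n i<k
      j-i≡a+1+b : j ∸ suc i ≡ a + suc b
      j-i≡a+1+b = begin
        j ∸ suc i                     ≡⟨ cong (_∸ suc i) (sym (m+[n∸m]≡n k<j)) ⟩
        (suc k + b) ∸ suc i           ≡⟨ cong (λ z → (suc z + b) ∸ suc i) (sym i+1+a≡k) ⟩
        (suc (suc i + a) + b) ∸ suc i ≡⟨ cong (_∸ suc i) (trans (sym (+-suc (suc i + a) b)) (+-assoc (suc i) a (suc b))) ⟩
        (suc i + (a + suc b)) ∸ suc i ≡⟨ m+n∸m≡n (suc i) (a + suc b) ⟩
        a + suc b                     ∎
      shift : ∀ t → f (suc a + t) ≡ g (suc k + t)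
      shift t = cong g (trans (sym (+-assoc (suc i) (suc a) t))
                              (cong (_+ t) (trans (+-suc (suc i) a) (cong suc i+1+a≡k))))

  -- Reading between g x y' through an inner return y would pop below the
  -- height at x; reading between g x y through an inner call x' would leave
  -- the height positive.
  private
    return-unique< : ∀ g x y y′ → Match A g x y → Match A g x y′ → y < y′ → ⊥
    return-unique< g x y y′ (s , x<y , kx , ky , wf) (s′ , x<y′ , kx′ , ky′ , wf′) y<y′
      with refl ← call-injective (trans (sym kx) kx′)
      with wellFormed⇒height wf′ 0
    ... | h≡0 rewrite between-split g x y y′ x<y y<y′
                    | height-++ s 0 (between A g x y) (g y ∷ between A g y y′)
                    | wellFormed⇒height wf 0 | heightStep-ret {s} 0 ky with h≡0
    ... | ()

    call-unique< : ∀ g x x′ y → Match A g x y → Match A g x′ y → x < x′ → ⊥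
    call-unique< g x x′ y (s , x<y , kx , ky , wf) (s′ , x′<y , kx′ , ky′ , wf′) x<x′
      with refl ← ret-injective (trans (sym ky) ky′)
      with wellFormed⇒height wf 0
    ... | h≡0 rewrite between-split g x x′ y x<x′ x′<y
                    | height-++ s 0 (between A g x x′) (g x′ ∷ between A g x′ y)
      with height s 0 (between A g x x′)
    ... | nothing = case h≡0 of λ ()
    ... | just h rewrite heightStep-call h kx′ | wellFormed⇒height wf′ (suc h) = case h≡0 of λ ()

  Match-functional : ∀ g {x y y′} → Match A g x y → Match A g x y′ → y ≡ y′
  Match-functional g {x} {y} {y′} m m′ with <-cmp y y′
  ... | tri< y<y′ _ _ = ⊥-elim (return-unique< g x y y′ m m′ y<y′)
  ... | tri≈ _ e _    = e
  ... | tri> _ _ y′<y = ⊥-elim (return-unique< g x y′ y m′ m y′<y)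

  Match-injective : ∀ g {x x′ y} → Match A g x y → Match A g x′ y → x ≡ x′
  Match-injective g {x} {x′} {y} m m′ with <-cmp x x′
  ... | tri< x<x′ _ _ = ⊥-elim (call-unique< g x x′ y m m′ x<x′)
  ... | tri≈ _ e _    = e
  ... | tri> _ _ x′<x = ⊥-elim (call-unique< g x′ x y m′ m x′<x)

module _ {A : Alphabet} (W : Struct A) where

  Edge-sym : ∀ {a b} → Edge A W a b → Edge A W b a
  Edge-sym (inj₁ (inj₁ e)) = inj₁ (inj₂ e)
  Edge-sym (inj₁ (inj₂ e)) = inj₁ (inj₁ e)
  Edge-sym (inj₂ (inj₁ e)) = inj₂ (inj₂ e)
  Edge-sym (inj₂ (inj₂ e)) = inj₂ (inj₁ e)

  Within-mono : ∀ {d d′ a b} → d ≤ d′ → Within A W d a b → Within A W d′ a b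
  Within-mono _         here       = here
  Within-mono (s≤s d≤d′) (step e w) = step e (Within-mono d≤d′ w)

  Within-snoc : ∀ {d a b c} → Within A W d a b → Edge A W b c → Within A W (suc d) a c
  Within-snoc here       e = step e here
  Within-snoc (step e′ w) e = step e′ (Within-snoc w e)

  Within-sym : ∀ {d a b} → Within A W d a b → Within A W d b a
  Within-sym here       = here
  Within-sym (step e w) = Within-mono ≤-refl (Within-snoc (Within-sym w) (Edge-sym e))

module _ {A : Alphabet} {m : ℕ} (V : Fin (suc m) → Sym A) where

  private
    S = finNW A V

  edge? : ∀ j k → Dec (Edge A S j k)
  edge? j k = ((toℕ k ≟ suc (toℕ j)) ⊎-dec (toℕ j ≟ suc (toℕ k)))
       ⊎-dec (match? A (extend A V) (toℕ j) (toℕ k) ⊎-dec match? A (extend A V) (toℕ k) (toℕ j))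

  within? : ∀ d j l → Dec (Within A S d j l)
  within? zero j l = map′ (λ { refl → here }) (λ { here → refl }) (j ≟ᶠ l)
  within? (suc d) j l = map′ fromSum toSum ((j ≟ᶠ l) ⊎-dec any? (λ c → edge? j c ×-dec within? d c l))
    where
      fromSum : j ≡ l ⊎ Σ (Fin (suc m)) (λ c → Edge A S j c × Within A S d c l) → Within A S (suc d) j l
      fromSum (inj₁ refl)          = here
      fromSum (inj₂ (c , e , w)) = step e w
      toSum : Within A S (suc d) j l → j ≡ l ⊎ Σ (Fin (suc m)) (λ c → Edge A S j c × Within A S d c l)
      toSum here       = inj₁ refl
      toSum (step e w) = inj₂ (_ , e , w)

module _ {P : ℕ → Set} (P? : Decidable P) where

  leastBelow : ∀ k → (Σ ℕ λ i → i < k × P i × (∀ j → j < i → ¬ P j)) ⊎ (∀ i → i < k → ¬ P i)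
  leastBelow zero = inj₂ λ i ()
  leastBelow (suc k) with leastBelow k
  ... | inj₁ (i , i<k , p , minimal) = inj₁ (i , m<n⇒m<1+n i<k , p , minimal)
  ... | inj₂ none with P? k
  ...   | yes p  = inj₁ (k , ≤-refl , p , none)
  ...   | no ¬p = inj₂ λ i i<1+k → [ none i , (λ { refl → ¬p }) ] (m<1+n⇒m<n∨m≡n i<1+k)

  least : ∀ k → P k → Σ ℕ λ i → i ≤ k × P i × (∀ j → j < i → ¬ P j)
  least k pk with leastBelow (suc k)
  ... | inj₁ (i , i<1+k , p , minimal) = i , ≤-pred i<1+k , p , minimal
  ... | inj₂ none = ⊥-elim (none k ≤-refl pk)

record Encoding (X : Set) : Set where
  field
    size          : ℕ
    encode        : X → Fin size
    decode        : Fin size → X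
    decode-encode : ∀ x → decode (encode x) ≡ x

  encode-injective : ∀ {x y} → encode x ≡ encode y → x ≡ y
  encode-injective {x} {y} e = trans (sym (decode-encode x)) (trans (cong decode e) (decode-encode y))

open Encoding

finEncoding : ∀ k → Encoding (Fin k)
finEncoding k = record { size = k ; encode = λ x → x ; decode = λ x → x ; decode-encode = λ _ → refl }

maybeEncoding : ∀ {X} → Encoding X → Encoding (Maybe X)
maybeEncoding E = record { size = suc (size E) ; encode = enc ; decode = dec ; decode-encode = dec-enc }
  where
    enc : _ → Fin (suc (size E))
    enc nothing  = Fin.zero
    enc (just x) = Fin.suc (encode E x)
    dec : Fin (suc (size E)) → _
    dec Fin.zero    = nothing
    dec (Fin.suc i) = just (decode E i)
    dec-enc : ∀ x → dec (enc x) ≡ x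
    dec-enc nothing  = refl
    dec-enc (just x) = cong just (decode-encode E x)
    import Data.Fin as Fin

boolEncoding : Encoding Bool
boolEncoding = record { size = 2 ; encode = enc ; decode = dec ; decode-encode = dec-enc }
  where
    enc : Bool → Fin 2
    enc false = Fin.zero
    enc true  = Fin.suc Fin.zero
    dec : Fin 2 → Bool
    dec Fin.zero    = false
    dec (Fin.suc _) = true
    dec-enc : ∀ b → dec (enc b) ≡ b
    dec-enc false = refl
    dec-enc true  = refl
    import Data.Fin as Fin

×-encoding : ∀ {X Y} → Encoding X → Encoding Y → Encoding (X × Y)
×-encoding {X} {Y} E F = record { size = size E * size F ; encode = enc ; decode = dec ; decode-encode = dec-enc }
  where
    enc : X × Y → Fin (size E * size F)
    enc (x , y) = combine (encode E x) (encode F y)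
    decodeBoth : Fin (size E) × Fin (size F) → X × Y
    decodeBoth (i , j) = decode E i , decode F j
    dec : Fin (size E * size F) → X × Y
    dec i = decodeBoth (remQuot (size F) i)
    dec-enc : ∀ p → dec (enc p) ≡ p
    dec-enc (x , y) = trans (cong decodeBoth (remQuot-combine (encode E x) (encode F y)))
                            (cong₂ _,_ (decode-encode E x) (decode-encode F y))

vecEncoding : ∀ {X} → Encoding X → ∀ k → Encoding (Vec X k)
vecEncoding E zero = record { size = 1 ; encode = λ _ → Data.Fin.zero ; decode = λ _ → []
                            ; decode-encode = λ { [] → refl } }
vecEncoding E (suc k) = record
  { size = size E×
  ; encode = λ { (x ∷ xs) → encode E× (x , xs) }
  ; decode = λ i → proj₁ (decode E× i) ∷ proj₂ (decode E× i)
  ; decode-encode = λ { (x ∷ xs) → cong (λ p → proj₁ p ∷ proj₂ p) (decode-encode E× (x , xs)) }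
  }
  where E× = ×-encoding E (vecEncoding E k)

-- The automaton

-- Guesses at the two ends of a ⋖- or μ-edge of W: a node whose partner is
-- unguessed must lie on the border of the ball and have no R-partner in it.
module _ {N : Set} (Inner : N → Set) (R : N → N → Set) (HasSucc HasPred : N → Set) where

  Compatible : Maybe N → Maybe N → Set
  Compatible (just j) (just k) = R j k
  Compatible (just j) nothing  = ¬ Inner j × ¬ HasSucc j
  Compatible nothing  (just k) = ¬ Inner k × ¬ HasPred k
  Compatible nothing  nothing  = ⊤

  compatible-from : ∀ {j} l → Compatible (just j) l →
    (l ≡ nothing × ¬ Inner j × ¬ HasSucc j) ⊎ Σ N λ k → l ≡ just k × R j k
  compatible-from nothing  c = inj₁ (refl , c)
  compatible-from (just k) c = inj₂ (k , refl , c)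

  compatible-to : ∀ {k} l → Compatible l (just k) →
    (l ≡ nothing × ¬ Inner k × ¬ HasPred k) ⊎ Σ N λ j → l ≡ just j × R j k
  compatible-to nothing  c = inj₁ (refl , c)
  compatible-to (just j) c = inj₂ (j , refl , c)

  module _ (inner? : ∀ j → Dec (Inner j)) (R? : ∀ j k → Dec (R j k))
           (hasSucc? : ∀ j → Dec (HasSucc j)) (hasPred? : ∀ j → Dec (HasPred j)) where

    compatible? : ∀ l l′ → Dec (Compatible l l′)
    compatible? (just j) (just k) = R? j k
    compatible? (just j) nothing  = ¬? (inner? j) ×-dec ¬? (hasSucc? j)
    compatible? nothing  (just k) = ¬? (inner? k) ×-dec ¬? (hasPred? k)
    compatible? nothing  nothing  = yes tt

module Automaton (A : Alphabet) (r m : ℕ) (V : Fin (suc m) → Sym A) (v : Fin (suc m)) where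

  Node : Set
  Node = Fin (suc m)

  S : Struct A
  S = finNW A V

  Ball : Node → Set
  Ball = Within A S r v

  ball? : ∀ j → Dec (Ball j)
  ball? = within? V r v

  -- at distance < r from v (the 0 < r guards against pred 0 = 0)
  Inner : Node → Set
  Inner j = 0 < r × Within A S (pred r) v j

  inner? : ∀ j → Dec (Inner j)
  inner? j = (0 <? r) ×-dec within? V (pred r) v j

  _⋖ᵛ_ : Node → Node → Set
  j ⋖ᵛ k = toℕ k ≡ suc (toℕ j)

  _↝ᵛ_ : Node → Node → Set
  j ↝ᵛ k = Match A (extend A V) (toℕ j) (toℕ k)

  HasNextInBall HasPrevInBall HasReturnInBall HasCallInBall : Node → Set
  HasNextInBall   j = Σ Node λ k → Ball k × j ⋖ᵛ k
  HasPrevInBall   k = Σ Node λ j → Ball j × j ⋖ᵛ k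
  HasReturnInBall j = Σ Node λ k → Ball k × j ↝ᵛ k
  HasCallInBall   k = Σ Node λ j → Ball j × j ↝ᵛ k

  ↝ᵛ? : ∀ j k → Dec (j ↝ᵛ k)
  ↝ᵛ? j k = match? A (extend A V) (toℕ j) (toℕ k)

  hasNextInBall? : ∀ j → Dec (HasNextInBall j)
  hasNextInBall? j = any? λ k → ball? k ×-dec (toℕ k ≟ suc (toℕ j))

  hasPrevInBall? : ∀ k → Dec (HasPrevInBall k)
  hasPrevInBall? k = any? λ j → ball? j ×-dec (toℕ k ≟ suc (toℕ j))

  hasReturnInBall? : ∀ j → Dec (HasReturnInBall j)
  hasReturnInBall? j = any? λ k → ball? k ×-dec ↝ᵛ? j k

  hasCallInBall? : ∀ k → Dec (HasCallInBall k)
  hasCallInBall? k = any? λ j → ball? j ×-dec ↝ᵛ? j k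

  Guess : Set
  Guess = Maybe Node

  Used : Set
  Used = Vec Bool (suc m)

  State : Set
  State = Guess × Used

  Complete : Used → Set
  Complete u = ∀ j → Ball j → lookup u j ≡ true

  complete? : ∀ u → Dec (Complete u)
  complete? u = all? {P = λ j → Ball j → lookup u j ≡ true} λ j → ball? j →-dec (lookup u j Bool.≟ true)

  unused : Used
  unused = replicate (suc m) false

  restartIf : ∀ {u} → Dec (Complete u) → Used
  restartIf (yes _) = unused
  restartIf {u} (no _) = u

  restart : Used → Used
  restart u = restartIf {u} (complete? u)

  mark : Used → Guess → Used
  mark u nothing  = u
  mark u (just k) = u [ k ]≔ true

  -- the guess l for a position labelled a, given the used set u of the previous position
  Fits : Used → Sym A → Guess → Set
  Fits u a nothing  = ⊤
  Fits u a (just k) = V k ≡ a × Ball k × lookup (restart u) k ≡ false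

  NextCompatible : Guess → Guess → Set
  NextCompatible = Compatible Inner _⋖ᵛ_ HasNextInBall HasPrevInBall

  MatchCompatible : Guess → Guess → Set
  MatchCompatible = Compatible Inner _↝ᵛ_ HasReturnInBall HasCallInBall

  NoCallInBall : Guess → Set
  NoCallInBall nothing  = ⊤
  NoCallInBall (just k) = ¬ HasCallInBall k

  MustReturn : Guess → Set
  MustReturn nothing  = ⊥
  MustReturn (just j) = HasReturnInBall j

  Step : State → Sym A → State → Set
  Step (l , u) a (l′ , u′) = Fits u a l′ × u′ ≡ mark (restart u) l′ × (Complete u → l′ ≡ nothing)
                           × NextCompatible l l′

  StepUnmatched : State → Sym A → State → Set
  StepUnmatched q a q′ = Step q a q′ × NoCallInBall (proj₁ q′)

  StepMatched : State → State → Sym A → State → Set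
  StepMatched qc q a q′ = Step q a q′ × MatchCompatible (proj₁ qc) (proj₁ q′)

  start : State
  start = nothing , unused

  fits? : ∀ u a l → Dec (Fits u a l)
  fits? u a nothing  = yes tt
  fits? u a (just k) = (V k ≟ᶠ a) ×-dec ball? k ×-dec (lookup (restart u) k Bool.≟ false)

  nextCompatible? : ∀ l l′ → Dec (NextCompatible l l′)
  nextCompatible? = compatible? Inner _⋖ᵛ_ HasNextInBall HasPrevInBall inner?
                      (λ j k → toℕ k ≟ suc (toℕ j)) hasNextInBall? hasPrevInBall?

  matchCompatible? : ∀ l l′ → Dec (MatchCompatible l l′)
  matchCompatible? = compatible? Inner _↝ᵛ_ HasReturnInBall HasCallInBall inner? ↝ᵛ? hasReturnInBall? hasCallInBall?

  noCallInBall? : ∀ l → Dec (NoCallInBall l)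
  noCallInBall? nothing  = yes tt
  noCallInBall? (just k) = ¬? (hasCallInBall? k)

  mustReturn? : ∀ l → Dec (MustReturn l)
  mustReturn? nothing  = no λ ()
  mustReturn? (just j) = hasReturnInBall? j

  step? : ∀ q a q′ → Dec (Step q a q′)
  step? (l , u) a (l′ , u′) = fits? u a l′ ×-dec Vec.≡-dec Bool._≟_ u′ (mark (restart u) l′)
                              ×-dec (complete? u →-dec Maybe.≡-dec _≟ᶠ_ l′ nothing) ×-dec nextCompatible? l l′

  stepUnmatched? : ∀ q a q′ → Dec (StepUnmatched q a q′)
  stepUnmatched? q a q′ = step? q a q′ ×-dec noCallInBall? (proj₁ q′)

  stepMatched? : ∀ qc q a q′ → Dec (StepMatched qc q a q′)
  stepMatched? qc q a q′ = step? q a q′ ×-dec matchCompatible? (proj₁ qc) (proj₁ q′)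

  _≟ˢᵗ_ : (q q′ : State) → Dec (q ≡ q′)
  (l , u) ≟ˢᵗ (l′ , u′) = map′ (λ { (refl , refl) → refl }) (λ { refl → refl , refl })
                                 (Maybe.≡-dec _≟ᶠ_ l l′ ×-dec Vec.≡-dec Bool._≟_ u u′)

  stateEncoding : Encoding State
  stateEncoding = ×-encoding (maybeEncoding (finEncoding (suc m))) (vecEncoding boolEncoding (suc m))

  ⟦_⟧ : Fin (size stateEncoding) → State
  ⟦_⟧ = decode stateEncoding

  automaton : GBA A
  automaton = record
    { states = size stateEncoding
    ; δ₁ = λ q a q′ → isYes (stepUnmatched? ⟦ q ⟧ a ⟦ q′ ⟧)
    ; δ₂ = λ qc q a q′ → isYes (stepMatched? ⟦ qc ⟧ ⟦ q ⟧ a ⟦ q′ ⟧)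
    ; QI = λ q → isYes (⟦ q ⟧ ≟ˢᵗ start)
    ; F  = λ q → isYes (complete? (proj₂ ⟦ q ⟧))
    ; C  = λ q → isYes (mustReturn? (proj₁ ⟦ q ⟧))
    }

  lookup-unused : ∀ j → lookup unused j ≡ false
  lookup-unused j = Vec.lookup-replicate j false

  unused-incomplete : ¬ Complete unused
  unused-incomplete c with () ← trans (sym (lookup-unused v)) (c v here)

  restart-cases : ∀ u → (Complete u × restart u ≡ unused) ⊎ (¬ Complete u × restart u ≡ u)
  restart-cases u with complete? u
  ... | yes c  = inj₁ (c , refl)
  ... | no ¬c = inj₂ (¬c , refl)

  restart-complete : ∀ {u} → Complete u → restart u ≡ unused
  restart-complete {u} c with restart-cases u
  ... | inj₁ (_ , e)  = e
  ... | inj₂ (¬c , _) = contradiction c ¬c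

  restart-incomplete : ∀ {u} → ¬ Complete u → restart u ≡ u
  restart-incomplete {u} ¬c with restart-cases u
  ... | inj₁ (c , _) = contradiction c ¬c
  ... | inj₂ (_ , e) = e

  lookup-mark-self : ∀ u j → lookup (mark u (just j)) j ≡ true
  lookup-mark-self u j = Vec.lookup∘update j u true

  lookup-mark-other : ∀ u {j k} → j ≢ k → lookup (mark u (just j)) k ≡ lookup u k
  lookup-mark-other u j≢k = Vec.lookup∘update′ (λ e → j≢k (sym e)) u true

  lookup-mark-keep : ∀ u l j → lookup u j ≡ true → lookup (mark u l) j ≡ true
  lookup-mark-keep u nothing  j e = e
  lookup-mark-keep u (just k) j e with k ≟ᶠ j
  ... | yes refl = lookup-mark-self u k
  ... | no k≢j  = trans (lookup-mark-other u k≢j) e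

  lookup-mark-inv : ∀ u l j → lookup (mark u l) j ≡ true → l ≡ just j ⊎ lookup u j ≡ true
  lookup-mark-inv u nothing  j e = inj₂ e
  lookup-mark-inv u (just k) j e with k ≟ᶠ j
  ... | yes refl = inj₁ refl
  ... | no k≢j  = inj₂ (trans (sym (lookup-mark-other u k≢j)) e)

  ↝ᵛ-functional : ∀ {a b b′} → a ↝ᵛ b → a ↝ᵛ b′ → b ≡ b′
  ↝ᵛ-functional p q = toℕ-injective (Match-functional A (extend A V) p q)

  ↝ᵛ-injective : ∀ {a a′ b} → a ↝ᵛ b → a′ ↝ᵛ b → a ≡ a′
  ↝ᵛ-injective p q = toℕ-injective (Match-injective A (extend A V) p q)

  ⋖ᵛ-functional : ∀ {a b b′} → a ⋖ᵛ b → a ⋖ᵛ b′ → b ≡ b′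
  ⋖ᵛ-functional p q = toℕ-injective (trans p (sym q))

  ⋖ᵛ-injective : ∀ {a a′ b} → a ⋖ᵛ b → a′ ⋖ᵛ b → a ≡ a′
  ⋖ᵛ-injective p q = toℕ-injective (suc-injective (trans (sym p) q))

  Within⇒Inner : ∀ {d j} → d < r → Within A S d v j → Inner j
  Within⇒Inner d<r w = ≤-<-trans z≤n d<r , Within-mono S (<⇒≤pred d<r) w

  record Accepting (g : ℕ → Sym A) (σ : ℕ → State) : Set where
    field
      step-start     : StepUnmatched start (g 0) (σ 0)
      step-matched   : ∀ p i → Match A g i (suc p) → StepMatched (σ i) (σ p) (g (suc p)) (σ (suc p))
      step-unmatched : ∀ p → (∀ i → ¬ Match A g i (suc p)) → StepUnmatched (σ p) (g (suc p)) (σ (suc p))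
      returns        : ∀ i → MustReturn (proj₁ (σ i)) → Σ ℕ λ j → Match A g i j
      completions    : ∀ k → Σ ℕ λ t → k ≤ t × Complete (proj₂ (σ t))

  accepts⇒accepting : ∀ {g} → Accepts A automaton g → Σ (ℕ → State) (Accepting g)
  accepts⇒accepting {g} (ρ , ((q , q-start , first) , steps) , (final , calls)) = (λ p → ⟦ ρ p ⟧) , record
    { step-start     = subst (λ q → StepUnmatched q (g 0) ⟦ ρ 0 ⟧) (toWitness q-start) (toWitness first)
    ; step-matched   = λ p i m → toWitness (proj₁ (steps p) i m)
    ; step-unmatched = λ p ¬m → toWitness (proj₂ (steps p) ¬m)
    ; returns        = λ i mr → proj₂ (calls i (fromWitness mr))
    ; completions    = λ k → let (t , k≤t , c) = final k in t , k≤t , toWitness c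
    }

  accepting⇒accepts : ∀ {g σ} → Accepting g σ → Accepts A automaton g
  accepting⇒accepts {g} {σ} run = ρ , (initial , λ p → matched p , unmatched p) , final , calls
    where
      open Accepting run
      ρ : ℕ → Fin (size stateEncoding)
      ρ p = encode stateEncoding (σ p)
      ⟦ρ⟧ : ∀ p → ⟦ ρ p ⟧ ≡ σ p
      ⟦ρ⟧ p = decode-encode stateEncoding (σ p)
      ⟦start⟧ : ⟦ encode stateEncoding start ⟧ ≡ start
      ⟦start⟧ = decode-encode stateEncoding start
      initialStep : True (stepUnmatched? ⟦ encode stateEncoding start ⟧ (g 0) ⟦ ρ 0 ⟧)
      initialStep = subst₂ (λ q q′ → True (stepUnmatched? q (g 0) q′)) (sym ⟦start⟧) (sym (⟦ρ⟧ 0))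
                           (fromWitness step-start)
      initial : Σ (Fin (size stateEncoding)) λ q → T (QI automaton q) × T (δ₁ automaton q (g 0) (ρ 0))
      initial = encode stateEncoding start , fromWitness ⟦start⟧ , initialStep
      matched : ∀ p i → Match A g i (suc p) → True (stepMatched? ⟦ ρ i ⟧ ⟦ ρ p ⟧ (g (suc p)) ⟦ ρ (suc p) ⟧)
      matched p i m =
        subst₂ (λ q q′ → True (stepMatched? q ⟦ ρ p ⟧ (g (suc p)) q′)) (sym (⟦ρ⟧ i)) (sym (⟦ρ⟧ (suc p)))
               (subst (λ q → True (stepMatched? (σ i) q (g (suc p)) (σ (suc p)))) (sym (⟦ρ⟧ p))
                      (fromWitness (step-matched p i m)))
      unmatched : ∀ p → (∀ i → ¬ Match A g i (suc p)) → True (stepUnmatched? ⟦ ρ p ⟧ (g (suc p)) ⟦ ρ (suc p) ⟧)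
      unmatched p ¬m = subst₂ (λ q q′ → True (stepUnmatched? q (g (suc p)) q′)) (sym (⟦ρ⟧ p)) (sym (⟦ρ⟧ (suc p)))
                              (fromWitness (step-unmatched p ¬m))
      final : InfinitelyOften A (λ t → True (complete? (proj₂ ⟦ ρ t ⟧)))
      final k = let (t , k≤t , c) = completions k in t , k≤t , fromWitness (subst (λ q → Complete (proj₂ q)) (sym (⟦ρ⟧ t)) c)
      calls : ∀ i → True (mustReturn? (proj₁ ⟦ ρ i ⟧)) →
              (Σ Stack λ s → kind A (g i) ≡ call s) × (Σ ℕ λ j → Match A g i j)
      calls i mr with returns i (subst (λ q → MustReturn (proj₁ q)) (⟦ρ⟧ i) (toWitness mr))
      ... | j , s , m = (s , proj₁ (proj₂ m)) , j , s , m

-- Soundness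

module Soundness (A : Alphabet) (r m : ℕ) (V : Fin (suc m) → Sym A) (v : Fin (suc m)) (g : ℕ → Sym A) where
  open Automaton A r m V v

  W : Struct A
  W = infNW A g

  hasCall? : ∀ y → Dec (Σ ℕ λ i → Match A g i y)
  hasCall? y = map′ (λ { (i , _ , m) → i , m }) (λ { (i , m) → i , proj₁ (proj₂ m) , m })
                    (anyUpTo? (λ i → match? A g i y) y)

  module Run {σ : ℕ → State} (accepting : Accepting g σ) where
    open Accepting accepting

    guess : ℕ → Guess
    guess p = proj₁ (σ p)

    used : ℕ → Used
    used p = proj₂ (σ p)

    before : ℕ → State
    before zero    = start
    before (suc p) = σ p

    step-at : ∀ p → Step (before p) (g p) (σ p)
    step-at zero = proj₁ step-start
    step-at (suc p) with hasCall? (suc p)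
    ... | yes (i , m) = proj₁ (step-matched p i m)
    ... | no ¬m       = proj₁ (step-unmatched p (λ i m → ¬m (i , m)))

    noCall-at : ∀ p → (∀ i → ¬ Match A g i p) → NoCallInBall (guess p)
    noCall-at zero    _  = proj₂ step-start
    noCall-at (suc p) ¬m = proj₂ (step-unmatched p ¬m)

    match-at : ∀ {i p} → Match A g i p → MatchCompatible (guess i) (guess p)
    match-at {p = zero}  (_ , () , _)
    match-at {p = suc p} m = proj₂ (step-matched p _ m)

    fits-at : ∀ {p k} → guess p ≡ just k → V k ≡ g p × Ball k × lookup (restart (proj₂ (before p))) k ≡ false
    fits-at {p} e = subst (Fits _ (g p)) e (proj₁ (step-at p))

    used-at : ∀ p → used p ≡ mark (restart (proj₂ (before p))) (guess p)
    used-at p = proj₁ (proj₂ (step-at p))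

    gap-after : ∀ p → Complete (used p) → guess (suc p) ≡ nothing
    gap-after p = proj₁ (proj₂ (proj₂ (step-at (suc p))))

    next-from : ∀ p {j} → guess p ≡ just j →
      (guess (suc p) ≡ nothing × ¬ Inner j × ¬ HasNextInBall j) ⊎ Σ Node λ k → guess (suc p) ≡ just k × j ⋖ᵛ k
    next-from p e = compatible-from Inner _⋖ᵛ_ HasNextInBall HasPrevInBall (guess (suc p))
                      (subst (λ l → NextCompatible l (guess (suc p))) e (proj₂ (proj₂ (proj₂ (step-at (suc p))))))

    next-to : ∀ p {k} → guess (suc p) ≡ just k →
      (guess p ≡ nothing × ¬ Inner k × ¬ HasPrevInBall k) ⊎ Σ Node λ j → guess p ≡ just j × j ⋖ᵛ k
    next-to p e = compatible-to Inner _⋖ᵛ_ HasNextInBall HasPrevInBall (guess p)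
                    (subst (NextCompatible (guess p)) e (proj₂ (proj₂ (proj₂ (step-at (suc p))))))

    match-from : ∀ {i p j} → Match A g i p → guess i ≡ just j →
      (guess p ≡ nothing × ¬ Inner j × ¬ HasReturnInBall j) ⊎ Σ Node λ k → guess p ≡ just k × j ↝ᵛ k
    match-from {p = p} m e = compatible-from Inner _↝ᵛ_ HasReturnInBall HasCallInBall (guess p)
                               (subst (λ l → MatchCompatible l (guess p)) e (match-at m))

    match-to : ∀ {i p k} → Match A g i p → guess p ≡ just k →
      (guess i ≡ nothing × ¬ Inner k × ¬ HasCallInBall k) ⊎ Σ Node λ j → guess i ≡ just j × j ↝ᵛ k
    match-to {i} m e = compatible-to Inner _↝ᵛ_ HasReturnInBall HasCallInBall (guess i)
                         (subst (MatchCompatible (guess i)) e (match-at m))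

    call-of : ∀ {p k} → guess p ≡ just k → HasCallInBall k → Σ ℕ λ i → Σ Node λ j → Match A g i p × guess i ≡ just j × j ↝ᵛ k
    call-of {p} e hc with hasCall? p
    ... | no ¬m = ⊥-elim (subst NoCallInBall e (noCall-at p λ i m → ¬m (i , m)) hc)
    ... | yes (i , m) with match-to m e
    ...   | inj₁ (_ , _ , ¬hc) = ⊥-elim (¬hc hc)
    ...   | inj₂ (j , e′ , j↝k) = i , j , m , e′ , j↝k

    NoCompletionIn : ℕ → ℕ → Set
    NoCompletionIn a b = ∀ t → a ≤ t → t < b → ¬ Complete (used t)

    NoCompletionIn-mono : ∀ {a b a′ b′} → a ≤ a′ → b′ ≤ b → NoCompletionIn a b → NoCompletionIn a′ b′
    NoCompletionIn-mono a≤a′ b′≤b none t a′≤t t<b′ = none t (≤-trans a≤a′ a′≤t) (<-≤-trans t<b′ b′≤b)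

    NoCompletionIn-join : ∀ {a b c} → NoCompletionIn a b → NoCompletionIn b c → NoCompletionIn a c
    NoCompletionIn-join {b = b} none₁ none₂ t a≤t t<c with t <? b
    ... | yes t<b = none₁ t a≤t t<b
    ... | no t≮b = none₂ t (≮⇒≥ t≮b) t<c

    firstCompletion : ∀ a b → NoCompletionIn a b ⊎ Σ ℕ λ e → a ≤ e × e < b × Complete (used e) × NoCompletionIn a e
    firstCompletion a b with leastBelow (λ t → (a ≤? t) ×-dec complete? (used t)) b
    ... | inj₁ (e , e<b , (a≤e , c) , minimal) = inj₂ (e , a≤e , e<b , c , λ t a≤t t<e c → minimal t t<e (a≤t , c))
    ... | inj₂ none = inj₁ λ t a≤t t<b c → none t t<b (a≤t , c)

    mutual
      used⇒guessed : ∀ q {j} → lookup (used q) j ≡ true → Σ ℕ λ z → z ≤ q × guess z ≡ just j × NoCompletionIn z q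
      used⇒guessed q {j} e with lookup-mark-inv _ (guess q) j (subst (λ u → lookup u j ≡ true) (used-at q) e)
      ... | inj₁ e′ = q , ≤-refl , e′ , λ t q≤t t<q → contradiction (<-≤-trans t<q q≤t) (<-irrefl refl)
      ... | inj₂ e′ = restartedUsed⇒guessed q e′

      restartedUsed⇒guessed : ∀ q {j} → lookup (restart (proj₂ (before q))) j ≡ true →
                               Σ ℕ λ z → z ≤ q × guess z ≡ just j × NoCompletionIn z q
      restartedUsed⇒guessed zero {j} e
        with () ← trans (sym (lookup-unused j)) (subst (λ u → lookup u j ≡ true) (restart-incomplete unused-incomplete) e)
      restartedUsed⇒guessed (suc q) {j} e with restart-cases (used q)
      ... | inj₁ (_ , e′) with () ← trans (sym (lookup-unused j)) (subst (λ u → lookup u j ≡ true) e′ e)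
      ... | inj₂ (¬c , e′) with used⇒guessed q (subst (λ u → lookup u j ≡ true) e′ e)
      ...   | z , z≤q , gz , none = z , m≤n⇒m≤1+n z≤q , gz ,
                NoCompletionIn-join none λ { t q≤t (s≤s t≤q) → subst (λ t → ¬ Complete (used t)) (≤-antisym q≤t t≤q) ¬c }

    guessed⇒used : ∀ {z j} q → guess z ≡ just j → z ≤ q → NoCompletionIn z q → lookup (used q) j ≡ true
    guessed⇒used {z} {j} q gz z≤q none with m≤n⇒m<n∨m≡n z≤q
    ... | inj₂ refl rewrite used-at z | gz = lookup-mark-self (restart (proj₂ (before z))) j
    ... | inj₁ z<q = later q z<q none
      where
        later : ∀ q → z < q → NoCompletionIn z q → lookup (used q) j ≡ true
        later (suc q) (s≤s z≤q) none with restart-cases (used q)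
        ... | inj₁ (c , _) = ⊥-elim (none q z≤q ≤-refl c)
        ... | inj₂ (_ , e) rewrite used-at (suc q) | e =
          lookup-mark-keep (used q) (guess (suc q)) j (guessed⇒used q gz z≤q (NoCompletionIn-mono ≤-refl (n≤1+n q) none))

    guess-unique : ∀ {x y j} → guess x ≡ just j → guess y ≡ just j → x < y → ¬ NoCompletionIn x y
    guess-unique {x} {suc y} {j} gx gy (s≤s x≤y) none with restart-cases (used y)
    ... | inj₁ (c , _) = none y x≤y ≤-refl c
    ... | inj₂ (_ , e) with () ← trans (sym (subst (λ u → lookup u j ≡ false) e (proj₂ (proj₂ (fits-at gy)))))
                                       (guessed⇒used y gx x≤y (NoCompletionIn-mono ≤-refl (n≤1+n y) none))

    -- If a completion e lay inside a guessed matching edge x ↝ y, the node k of y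
    -- would have been guessed before e at some z, whose call partner x′ must
    -- carry the guess of x again; this repeats a guess within one round.
    match-noCompletion : ∀ {x y j k} → Match A g x y → guess x ≡ just j → guess y ≡ just k → NoCompletionIn x y
    match-noCompletion {y = y} = go y (<-wellFounded y)
      where
        go : ∀ y → Acc _<_ y → ∀ {x j k} → Match A g x y → guess x ≡ just j → guess y ≡ just k → NoCompletionIn x y
        go y (acc smaller) {x} {j} {k} m gx gy with firstCompletion x y
        ... | inj₁ none = none
        ... | inj₂ (e , x≤e , e<y , c , none-xe) with used⇒guessed e (c k (proj₁ (proj₂ (fits-at gy))))
        ... | z , z≤e , gz , none-ze with match-from m gx
        ...   | inj₁ (gy′ , _) with () ← trans (sym gy) gy′
        ...   | inj₂ (_ , gy′ , j↝k) with refl ← trans (sym gy) gy′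
                with call-of gz (j , proj₁ (proj₂ (fits-at gx)) , j↝k)
        ... | x′ , j′ , m′ , gx′ , j′↝k with refl ← ↝ᵛ-injective j′↝k j↝k
                with go z (smaller (≤-<-trans z≤e e<y)) m′ gx′ gz | <-cmp x x′
        ... | none-x′z | tri< x<x′ _ _ =
              ⊥-elim (guess-unique gx gx′ x<x′ (NoCompletionIn-mono ≤-refl (≤-trans (<⇒≤ (proj₁ (proj₂ m′))) z≤e) none-xe))
        ... | none-x′z | tri> _ _ x′<x =
              ⊥-elim (guess-unique gx′ gx x′<x (NoCompletionIn-mono ≤-refl x≤e (NoCompletionIn-join none-x′z none-ze)))
        ... | _ | tri≈ _ refl _ = ⊥-elim (<-irrefl (Match-functional A g m′ m) (≤-<-trans z≤e e<y))

    module Copy (t₁ e : ℕ) (t₁<e : t₁ < e) (c₁ : Complete (used t₁)) (cₑ : Complete (used e))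
                (none : NoCompletionIn (suc t₁) e) where

      InRound : ℕ → Set
      InRound p = t₁ < p × p ≤ e

      inRound? : ∀ p → Dec (InRound p)
      inRound? p = (t₁ <? p) ×-dec (p ≤? e)

      Guessed : ℕ → Node → Set
      Guessed p j = InRound p × guess p ≡ just j

      guessed : ∀ {j} → Ball j → Σ ℕ λ p → Guessed p j
      guessed b with used⇒guessed e (cₑ _ b)
      ... | z , z≤e , gz , none-ze with t₁ <? z
      ...   | yes t₁<z = z , (t₁<z , z≤e) , gz
      ...   | no t₁≮z = ⊥-elim (none-ze t₁ (≮⇒≥ t₁≮z) t₁<e c₁)

      guessed-unique : ∀ {p p′ j} → Guessed p j → Guessed p′ j → p ≡ p′
      guessed-unique {p} {p′} ((t₁<p , p≤e) , gp) ((t₁<p′ , p′≤e) , gp′) with <-cmp p p′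
      ... | tri< p<p′ _ _ = ⊥-elim (guess-unique gp gp′ p<p′ (NoCompletionIn-mono t₁<p p′≤e none))
      ... | tri≈ _ p≡p′ _ = p≡p′
      ... | tri> _ _ p′<p = ⊥-elim (guess-unique gp′ gp p′<p (NoCompletionIn-mono t₁<p′ p≤e none))

      positionIf : ∀ j → Dec (Ball j) → ℕ
      positionIf j (yes b) = proj₁ (guessed b)
      positionIf j (no _)  = 0

      position : Node → ℕ
      position j = positionIf j (ball? j)

      position-spec : ∀ {j} → Ball j → Guessed (position j) j
      position-spec {j} b with ball? j
      ... | yes b′ = proj₂ (guessed b′)
      ... | no ¬b = contradiction b ¬b

      position-unique : ∀ {j p} → Ball j → Guessed p j → position j ≡ p
      position-unique b gp = guessed-unique (position-spec b) gp

      nodeIf : ∀ {p} → Dec (InRound p) → Guess → Node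
      nodeIf (yes _) (just j) = j
      nodeIf _       _        = v

      node : ℕ → Node
      node p = nodeIf (inRound? p) (guess p)

      node-spec : ∀ {p j} → Guessed p j → node p ≡ j
      node-spec {p} (ip , gp) with inRound? p
      ... | yes _ rewrite gp = refl
      ... | no ¬ip = contradiction ip ¬ip

      InRound-suc : ∀ {x k} → InRound x → guess (suc x) ≡ just k → InRound (suc x)
      InRound-suc (t₁<x , x≤e) gk with m≤n⇒m<n∨m≡n x≤e
      ... | inj₁ x<e = m<n⇒m<1+n t₁<x , x<e
      ... | inj₂ refl with () ← trans (sym gk) (gap-after _ cₑ)

      InRound-pred : ∀ {y k} → InRound (suc y) → guess (suc y) ≡ just k → InRound y
      InRound-pred {y} (t₁<y+1 , y+1≤e) gk with t₁ <? y
      ... | yes t₁<y = t₁<y , ≤-trans (n≤1+n y) y+1≤e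
      ... | no t₁≮y with refl ← ≤-antisym (≮⇒≥ t₁≮y) (≤-pred t₁<y+1)
                    with () ← trans (sym gk) (gap-after t₁ c₁)

      InRound-forward : ∀ {x y} → InRound x → x < y → NoCompletionIn x y → InRound y
      InRound-forward {y = y} (t₁<x , x≤e) x<y none-xy with y ≤? e
      ... | yes y≤e = <-trans t₁<x x<y , y≤e
      ... | no y≰e = ⊥-elim (none-xy e x≤e (≰⇒> y≰e) cₑ)

      InRound-backward : ∀ {x y} → InRound x → y < x → NoCompletionIn y x → InRound y
      InRound-backward {y = y} (t₁<x , x≤e) y<x none-yx with t₁ <? y
      ... | yes t₁<y = t₁<y , ≤-trans (<⇒≤ y<x) x≤e
      ... | no t₁≮y = ⊥-elim (none-yx t₁ (≮⇒≥ t₁≮y) t₁<x c₁)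

      forward-⋖ : ∀ {x a b} → Guessed x a → Ball b → a ⋖ᵛ b → Guessed (suc x) b
      forward-⋖ {x} (ix , gx) bb a⋖b with next-from x gx
      ... | inj₁ (_ , _ , ¬hn) = ⊥-elim (¬hn (_ , bb , a⋖b))
      ... | inj₂ (k , gk , a⋖k) with refl ← ⋖ᵛ-functional a⋖k a⋖b = InRound-suc ix gk , gk

      backward-⋖ : ∀ {x a b} → Guessed x a → Ball b → b ⋖ᵛ a → Σ ℕ λ y → x ≡ suc y × Guessed y b
      backward-⋖ {zero} ((() , _) , _) bb b⋖a
      backward-⋖ {suc y} (ix , gx) bb b⋖a with next-to y gx
      ... | inj₁ (_ , _ , ¬hp) = ⊥-elim (¬hp (_ , bb , b⋖a))
      ... | inj₂ (k , gk , k⋖a) with refl ← ⋖ᵛ-injective k⋖a b⋖a = y , refl , InRound-pred ix gx , gk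

      forward-↝ : ∀ {x a b} → Guessed x a → Ball b → a ↝ᵛ b → Σ ℕ λ y → Match A g x y × Guessed y b
      forward-↝ {x} (ix , gx) bb a↝b with returns x (subst MustReturn (sym gx) (_ , bb , a↝b))
      ... | y , m with match-from m gx
      ...   | inj₁ (_ , _ , ¬hr) = ⊥-elim (¬hr (_ , bb , a↝b))
      ...   | inj₂ (k , gy , a↝k) with refl ← ↝ᵛ-functional a↝k a↝b =
              y , m , InRound-forward ix (proj₁ (proj₂ m)) (match-noCompletion m gx gy) , gy

      backward-↝ : ∀ {x a b} → Guessed x a → Ball b → b ↝ᵛ a → Σ ℕ λ y → Match A g y x × Guessed y b
      backward-↝ (ix , gx) bb b↝a with call-of gx (_ , bb , b↝a)
      ... | y , k , m , gy , k↝a with refl ← ↝ᵛ-injective k↝a b↝a =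
            y , m , InRound-backward ix (proj₁ (proj₂ m)) (match-noCompletion m gy gx) , gy

      edge-to-position : ∀ {x a b} → Guessed x a → Ball b → Edge A S a b → Σ ℕ λ y → Guessed y b × Edge A W x y
      edge-to-position gx bb (inj₁ (inj₁ a⋖b)) = _ , forward-⋖ gx bb a⋖b , inj₁ (inj₁ refl)
      edge-to-position gx bb (inj₁ (inj₂ b⋖a)) with backward-⋖ gx bb b⋖a
      ... | y , refl , gy = y , gy , inj₁ (inj₂ refl)
      edge-to-position gx bb (inj₂ (inj₁ a↝b)) with forward-↝ gx bb a↝b
      ... | y , m , gy = y , gy , inj₂ (inj₁ m)
      edge-to-position gx bb (inj₂ (inj₂ b↝a)) with backward-↝ gx bb b↝a
      ... | y , m , gy = y , gy , inj₂ (inj₂ m)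

      edge-to-node : ∀ {x y j} → Guessed x j → Inner j → Edge A W x y → Σ Node λ k → Guessed y k × Edge A S j k
      edge-to-node {x} (ix , gx) inner (inj₁ (inj₁ refl)) with next-from x gx
      ... | inj₁ (_ , ¬inner , _) = ⊥-elim (¬inner inner)
      ... | inj₂ (k , gk , j⋖k) = k , (InRound-suc ix gk , gk) , inj₁ (inj₁ j⋖k)
      edge-to-node {suc y} (ix , gx) inner (inj₁ (inj₂ refl)) with next-to y gx
      ... | inj₁ (_ , ¬inner , _) = ⊥-elim (¬inner inner)
      ... | inj₂ (k , gk , k⋖j) = k , (InRound-pred ix gx , gk) , inj₁ (inj₂ k⋖j)
      edge-to-node (ix , gx) inner (inj₂ (inj₁ m)) with match-from m gx
      ... | inj₁ (_ , ¬inner , _) = ⊥-elim (¬inner inner)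
      ... | inj₂ (k , gy , j↝k) =
            k , (InRound-forward ix (proj₁ (proj₂ m)) (match-noCompletion m gx gy) , gy) , inj₂ (inj₁ j↝k)
      edge-to-node (ix , gx) inner (inj₂ (inj₂ m)) with match-to m gx
      ... | inj₁ (_ , ¬inner , _) = ⊥-elim (¬inner inner)
      ... | inj₂ (k , gy , k↝j) =
            k , (InRound-backward ix (proj₁ (proj₂ m)) (match-noCompletion m gy gx) , gy) , inj₂ (inj₂ k↝j)

      walk-to-node : ∀ {d e′ x y j} → d + e′ ≤ r → Within A S d v j → Guessed x j → Within A W e′ x y →
                     Σ Node λ k → Guessed y k × Ball k
      walk-to-node {d} le wj gx here = _ , gx , Within-mono S (m+n≤o⇒m≤o d le) wj
      walk-to-node {d} {suc e″} le wj gx (step ed w) =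
        let le′ = subst (_≤ r) (+-suc d e″) le
            (k , gk , ek) = edge-to-node gx (Within⇒Inner (m+n≤o⇒m≤o (suc d) le′) wj) ed
        in walk-to-node le′ (Within-snoc S wj ek) gk w

      walk-to-position : ∀ {d e′ a b x c} → d + e′ ≤ r → Within A S d v a → Guessed x a → Within A W d c x →
                         Within A S e′ a b → Σ ℕ λ y → Guessed y b × Within A W r c y
      walk-to-position {d} le wa gx wx here = _ , gx , Within-mono W (m+n≤o⇒m≤o d le) wx
      walk-to-position {d} {suc e″} le wa gx wx (step ed w) =
        let le′ = subst (_≤ r) (+-suc d e″) le
            wa₁ = Within-snoc S wa ed
            (y₁ , gy₁ , ew) = edge-to-position gx (Within-mono S (m+n≤o⇒m≤o (suc d) le′) wa₁) ed
        in walk-to-position le′ wa₁ gy₁ (Within-snoc W wx ew) w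

      guessed-⋖ : ∀ {y z j k} → Guessed y j → Guessed z k → z ≡ suc y → j ⋖ᵛ k
      guessed-⋖ {y} {j = j} (_ , gy) (_ , gz) refl with next-from y gy
      ... | inj₁ (gz′ , _) = contradiction (trans (sym gz) gz′) λ ()
      ... | inj₂ (k , gz′ , j⋖k) = subst (j ⋖ᵛ_) (Maybe.just-injective (trans (sym gz′) gz)) j⋖k

      guessed-↝ : ∀ {y z j k} → Guessed y j → Guessed z k → Match A g y z → j ↝ᵛ k
      guessed-↝ {j = j} (_ , gy) (_ , gz) m with match-from m gy
      ... | inj₁ (gz′ , _) = contradiction (trans (sym gz) gz′) λ ()
      ... | inj₂ (k , gz′ , j↝k) = subst (j ↝ᵛ_) (Maybe.just-injective (trans (sym gz′) gz)) j↝k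

      center : ℕ
      center = proj₁ (guessed here)

      center-guessed : Guessed center v
      center-guessed = proj₂ (guessed here)

      node-in-ball : ∀ {y} → Within A W r center y → Σ Node λ k → Guessed y k × Ball k
      node-in-ball = walk-to-node ≤-refl here center-guessed

      position-in-sphere : ∀ {j} → Ball j → Σ ℕ λ y → Guessed y j × Within A W r center y
      position-in-sphere = walk-to-position ≤-refl here center-guessed here

      sphere : SphIso A r W center S v
      sphere = node , position , node-spec center-guessed
             , to-ball , to-sphere , position∘node , node∘position , labels , nexts , matches
        where
          to-ball : ∀ y → Within A W r center y → Ball (node y)
          to-ball y w = let (k , gy , bk) = node-in-ball w in subst Ball (sym (node-spec gy)) bk
          to-sphere : ∀ j → Ball j → Within A W r center (position j)
          to-sphere j b = let (y , gy , wy) = position-in-sphere b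
                          in subst (Within A W r center) (sym (position-unique b gy)) wy
          position∘node : ∀ y → Within A W r center y → position (node y) ≡ y
          position∘node y w = let (k , gy , bk) = node-in-ball w
                              in trans (cong position (node-spec gy)) (position-unique bk gy)
          node∘position : ∀ j → Ball j → node (position j) ≡ j
          node∘position j b = node-spec (position-spec b)
          labels : ∀ y → Within A W r center y → V (node y) ≡ g y
          labels y w = let (k , gy , bk) = node-in-ball w
                       in trans (cong V (node-spec gy)) (proj₁ (fits-at (proj₂ gy)))
          nexts : ∀ y z → Within A W r center y → Within A W r center z → (z ≡ suc y) ⇔ (node y ⋖ᵛ node z)
          nexts y z wy wz with node-in-ball wy | node-in-ball wz
          ... | ky , gy , _ | kz , gz , bz =
            subst₂ (λ a b → (z ≡ suc y) ⇔ (a ⋖ᵛ b)) (sym (node-spec gy)) (sym (node-spec gz))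
                   (mk⇔ (guessed-⋖ gy gz) (λ ky⋖kz → guessed-unique gz (forward-⋖ gy bz ky⋖kz)))
          matches : ∀ y z → Within A W r center y → Within A W r center z → Match A g y z ⇔ (node y ↝ᵛ node z)
          matches y z wy wz with node-in-ball wy | node-in-ball wz
          ... | ky , gy , _ | kz , gz , bz =
            subst₂ (λ a b → Match A g y z ⇔ (a ↝ᵛ b)) (sym (node-spec gy)) (sym (node-spec gz))
                   (mk⇔ (guessed-↝ gy gz) λ ky↝kz → let (y′ , m , gy′) = forward-↝ gy bz ky↝kz
                                                   in subst (Match A g y) (guessed-unique gy′ gz) m)

    spheres : InfinitelyOften A (λ i → SphIso A r W i S v)
    spheres k with completions k
    ... | t₁ , k≤t₁ , c₁ with completions (suc t₁)
    ... | t₂ , t₁<t₂ , c₂ with firstCompletion (suc t₁) (suc t₂)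
    ... | inj₁ none = ⊥-elim (none t₂ t₁<t₂ ≤-refl c₂)
    ... | inj₂ (e , t₁<e , _ , cₑ , none) =
          center , ≤-trans k≤t₁ (<⇒≤ (proj₁ (proj₁ center-guessed))) , sphere
      where open Copy t₁ e t₁<e c₁ cₑ none

-- Completeness

module Embedding (A : Alphabet) (r m : ℕ) (V : Fin (suc m) → Sym A) (v : Fin (suc m))
                 (g : ℕ → Sym A) {i : ℕ} (iso : SphIso A r (infNW A g) i (finNW A V) v) where
  open Automaton A r m V v

  W : Struct A
  W = infNW A g

  InSphere : ℕ → Set
  InSphere = Within A W r i

  to : ℕ → Node
  to = proj₁ iso

  from : Node → ℕ
  from = proj₁ (proj₂ iso)

  to-center : to i ≡ v
  to-center = let (_ , _ , e , _) = iso in e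

  to-ball : ∀ {q} → InSphere q → Ball (to q)
  to-ball = let (_ , _ , _ , f , _) = iso in f _

  from-sphere : ∀ {j} → Ball j → InSphere (from j)
  from-sphere = let (_ , _ , _ , _ , f , _) = iso in f _

  from-to : ∀ {q} → InSphere q → from (to q) ≡ q
  from-to = let (_ , _ , _ , _ , _ , f , _) = iso in f _

  to-from : ∀ {j} → Ball j → to (from j) ≡ j
  to-from = let (_ , _ , _ , _ , _ , _ , f , _) = iso in f _

  to-label : ∀ {q} → InSphere q → V (to q) ≡ g q
  to-label = let (_ , _ , _ , _ , _ , _ , _ , f , _) = iso in f _

  to-⋖ : ∀ {q q′} → InSphere q → InSphere q′ → (q′ ≡ suc q) ⇔ (to q ⋖ᵛ to q′)
  to-⋖ = let (_ , _ , _ , _ , _ , _ , _ , _ , f , _) = iso in f _ _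

  to-↝ : ∀ {q q′} → InSphere q → InSphere q′ → Match A g q q′ ⇔ (to q ↝ᵛ to q′)
  to-↝ = let (_ , _ , _ , _ , _ , _ , _ , _ , _ , f) = iso in f _ _

  inSphere? : ∀ q → Dec (InSphere q)
  inSphere? q = map′ (λ (b , e) → subst InSphere e (from-sphere b)) (λ w → to-ball w , from-to w)
                     (ball? (to q) ×-dec (from (to q) ≟ q))

  from-center : from v ≡ i
  from-center = trans (cong from (sym to-center)) (from-to here)

  from-⋖ : ∀ {a b} → Ball a → Ball b → a ⋖ᵛ b → from b ≡ suc (from a)
  from-⋖ ba bb a⋖b = Equivalence.from (to-⋖ (from-sphere ba) (from-sphere bb))
                       (subst₂ _⋖ᵛ_ (sym (to-from ba)) (sym (to-from bb)) a⋖b)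

  from-↝ : ∀ {a b} → Ball a → Ball b → a ↝ᵛ b → Match A g (from a) (from b)
  from-↝ ba bb a↝b = Equivalence.from (to-↝ (from-sphere ba) (from-sphere bb))
                       (subst₂ _↝ᵛ_ (sym (to-from ba)) (sym (to-from bb)) a↝b)

  from-edge : ∀ {a b} → Ball a → Ball b → Edge A S a b → Edge A W (from a) (from b)
  from-edge ba bb (inj₁ (inj₁ a⋖b)) = inj₁ (inj₁ (from-⋖ ba bb a⋖b))
  from-edge ba bb (inj₁ (inj₂ b⋖a)) = inj₁ (inj₂ (from-⋖ bb ba b⋖a))
  from-edge ba bb (inj₂ (inj₁ a↝b)) = inj₂ (inj₁ (from-↝ ba bb a↝b))
  from-edge ba bb (inj₂ (inj₂ b↝a)) = inj₂ (inj₂ (from-↝ bb ba b↝a))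

  from-walk : ∀ {d e a b} → d + e ≤ r → Within A S d v a → Within A W d i (from a) → Within A S e a b →
              Within A W (d + e) i (from b)
  from-walk {d} {e} le wa wfa here = Within-mono W (m≤m+n d e) wfa
  from-walk {d} {suc e} {b = b} le wa wfa (step ed w) =
    let le′ = subst (_≤ r) (+-suc d e) le
        wa₁ = Within-snoc S wa ed
        ba  = Within-mono S (<⇒≤ (m+n≤o⇒m≤o (suc d) le′)) wa
        ba₁ = Within-mono S (m+n≤o⇒m≤o (suc d) le′) wa₁
    in subst (λ z → Within A W z i (from b)) (sym (+-suc d e))
             (from-walk le′ wa₁ (Within-snoc W wfa (from-edge ba ba₁ ed)) w)

  from-within : ∀ {d j} → d ≤ r → Within A S d v j → Within A W d i (from j)
  from-within le = from-walk {0} le here (subst (Within A W 0 i) (sym from-center) here)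

  inner-edge : ∀ {q y} → InSphere q → Inner (to q) → Edge A W q y → InSphere y
  inner-edge {q} {y} wq (0<r , wv) e =
    subst (λ z → Within A W z i y) (suc-pred r {{>-nonZero 0<r}})
          (Within-snoc W (subst (Within A W (pred r) i) (from-to wq) (from-within pred[n]≤n wv)) e)

  inside-⋖ : ∀ {p} → InSphere p → InSphere (suc p) → to p ⋖ᵛ to (suc p)
  inside-⋖ w w′ = Equivalence.to (to-⋖ w w′) refl

  leaving-⋖ : ∀ {p} → InSphere p → ¬ InSphere (suc p) → ¬ Inner (to p) × ¬ HasNextInBall (to p)
  leaving-⋖ w ¬w′ = (λ inner → ¬w′ (inner-edge w inner (inj₁ (inj₁ refl))))
                  , λ (k , bk , p⋖k) → ¬w′ (subst InSphere (trans (from-⋖ (to-ball w) bk p⋖k) (cong suc (from-to w)))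
                                                        (from-sphere bk))

  entering-⋖ : ∀ {p} → ¬ InSphere p → InSphere (suc p) → ¬ Inner (to (suc p)) × ¬ HasPrevInBall (to (suc p))
  entering-⋖ ¬w w′ = (λ inner → ¬w (inner-edge w′ inner (inj₁ (inj₂ refl))))
                   , λ (k , bk , k⋖p) → ¬w (subst InSphere (suc-injective (trans (sym (from-⋖ bk (to-ball w′) k⋖p)) (from-to w′)))
                                                       (from-sphere bk))

  inside-↝ : ∀ {x y} → InSphere x → InSphere y → Match A g x y → to x ↝ᵛ to y
  inside-↝ wx wy = Equivalence.to (to-↝ wx wy)

  return-of : ∀ {x k} → InSphere x → Ball k → to x ↝ᵛ k → Match A g x (from k)
  return-of wx bk x↝k = subst (λ z → Match A g z _) (from-to wx) (from-↝ (to-ball wx) bk x↝k)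

  call-of : ∀ {y k} → InSphere y → Ball k → k ↝ᵛ to y → Match A g (from k) y
  call-of wy bk k↝y = subst (Match A g _) (from-to wy) (from-↝ bk (to-ball wy) k↝y)

  leaving-↝ : ∀ {x y} → InSphere x → ¬ InSphere y → Match A g x y → ¬ Inner (to x) × ¬ HasReturnInBall (to x)
  leaving-↝ wx ¬wy m = (λ inner → ¬wy (inner-edge wx inner (inj₂ (inj₁ m))))
                     , λ (k , bk , x↝k) → ¬wy (subst InSphere (Match-functional A g (return-of wx bk x↝k) m) (from-sphere bk))

  entering-↝ : ∀ {x y} → ¬ InSphere x → InSphere y → Match A g x y → ¬ Inner (to y) × ¬ HasCallInBall (to y)
  entering-↝ ¬wx wy m = (λ inner → ¬wx (inner-edge wy inner (inj₂ (inj₂ m))))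
                      , λ (k , bk , k↝y) → ¬wx (subst InSphere (Match-injective A g (call-of wy bk k↝y) m) (from-sphere bk))

  -- The copy comes within distance 1 of the positions 0 … M + 1.
  Near : ℕ → Set
  Near M = (Σ Node λ j → Ball j × from j ≤ suc M) ⊎ (Σ Node λ j → Ball j × Σ ℕ λ x → x < suc M × Match A g x (from j))

  near? : ∀ M → Dec (Near M)
  near? M = any? (λ j → ball? j ×-dec (from j ≤? suc M))
            ⊎-dec any? (λ j → ball? j ×-dec anyUpTo? (λ x → match? A g x (from j)) (suc M))

  far-positions : ∀ {M q} → ¬ Near M → InSphere q → suc M < q
  far-positions {M} {q} ¬near w with q ≤? suc M
  ... | yes q≤ = contradiction (inj₁ (to q , to-ball w , subst (_≤ suc M) (sym (from-to w)) q≤)) ¬near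
  ... | no q≰ = ≰⇒> q≰

  far-calls : ∀ {M q x} → ¬ Near M → InSphere q → Match A g x q → M < x
  far-calls {M} {q} {x} ¬near w m with x ≤? M
  ... | yes x≤ = contradiction (inj₂ (to q , to-ball w , x , s≤s x≤ , subst (Match A g x) (sym (from-to w)) m)) ¬near
  ... | no x≰ = ≰⇒> x≰

  near⇒walk : ∀ {M} → Near M → Σ ℕ λ p → p ≤ suc M × Within A W (suc r) p i
  near⇒walk (inj₁ (j , bj , le)) = from j , le , Within-mono W (n≤1+n r) (Within-sym W (from-sphere bj))
  near⇒walk (inj₂ (j , bj , x , x<1+M , m)) =
    x , ≤-trans (≤-pred x<1+M) (n≤1+n _) , step (inj₂ (inj₁ m)) (Within-sym W (from-sphere bj))

  ballNodes : List Node
  ballNodes = filter ball? (allFin (suc m))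

  top : ℕ
  top = from (argmax from v ballNodes)

  top-inSphere : InSphere top
  top-inSphere = from-sphere (argmax-all from here (all-filter ball? (allFin (suc m))))

  ≤-top : ∀ {q} → InSphere q → q ≤ top
  ≤-top {q} w = subst (_≤ top) (from-to w)
                  (lookupᴬ (f[xs]≤f[argmax] {f = from} v ballNodes) (∈-filter⁺ ball? (∈-allFin (to q)) (to-ball w)))

data Dir : Set where
  stay forward backward toReturn toCall : Dir

dirEncoding : Encoding Dir
dirEncoding = record { size = 5 ; encode = enc ; decode = dec ; decode-encode = dec-enc }
  where
    open Data.Fin using (zero; suc)
    enc : Dir → Fin 5
    enc stay     = zero
    enc forward  = suc zero
    enc backward = suc (suc zero)
    enc toReturn = suc (suc (suc zero))
    enc toCall   = suc (suc (suc (suc zero)))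
    dec : Fin 5 → Dir
    dec zero                      = stay
    dec (suc zero)                = forward
    dec (suc (suc zero))          = backward
    dec (suc (suc (suc zero)))    = toReturn
    dec (suc (suc (suc (suc _)))) = toCall
    dec-enc : ∀ d → dec (enc d) ≡ d
    dec-enc stay     = refl
    dec-enc forward  = refl
    dec-enc backward = refl
    dec-enc toReturn = refl
    dec-enc toCall   = refl

module Walks (A : Alphabet) (g : ℕ → Sym A) where

  W : Struct A
  W = infNW A g

  Follows : ℕ → ∀ {k} → Vec Dir k → ℕ → Set
  Follows a []              b = a ≡ b
  Follows a (stay ∷ ds)     b = Follows a ds b
  Follows a (forward ∷ ds)  b = Follows (suc a) ds b
  Follows a (backward ∷ ds) b = Σ ℕ λ a′ → a ≡ suc a′ × Follows a′ ds b
  Follows a (toReturn ∷ ds) b = Σ ℕ λ a′ → Match A g a a′ × Follows a′ ds b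
  Follows a (toCall ∷ ds)   b = Σ ℕ λ a′ → Match A g a′ a × Follows a′ ds b

  Follows-deterministic : ∀ {k} (ds : Vec Dir k) {a b b′} → Follows a ds b → Follows a ds b′ → b ≡ b′
  Follows-deterministic []              e e′ = trans (sym e) e′
  Follows-deterministic (stay ∷ ds)     f f′ = Follows-deterministic ds f f′
  Follows-deterministic (forward ∷ ds)  f f′ = Follows-deterministic ds f f′
  Follows-deterministic (backward ∷ ds) (a₁ , e₁ , f) (a₂ , e₂ , f′)
    with refl ← suc-injective (trans (sym e₁) e₂) = Follows-deterministic ds f f′
  Follows-deterministic (toReturn ∷ ds) (a₁ , m₁ , f) (a₂ , m₂ , f′)
    with refl ← Match-functional A g m₁ m₂ = Follows-deterministic ds f f′
  Follows-deterministic (toCall ∷ ds)   (a₁ , m₁ , f) (a₂ , m₂ , f′)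
    with refl ← Match-injective A g m₁ m₂ = Follows-deterministic ds f f′

  stays : ∀ d a → Follows a (replicate d stay) a
  stays zero    a = refl
  stays (suc d) a = stays d a

  within⇒follows : ∀ {d a b} → Within A W d a b → Σ (Vec Dir d) λ ds → Follows a ds b
  within⇒follows {d} {a} here = replicate d stay , stays d a
  within⇒follows (step e w) with within⇒follows w | e
  ... | ds , f | inj₁ (inj₁ refl) = forward ∷ ds , f
  ... | ds , f | inj₁ (inj₂ refl) = backward ∷ ds , _ , refl , f
  ... | ds , f | inj₂ (inj₁ m)    = toReturn ∷ ds , _ , m , f
  ... | ds , f | inj₂ (inj₂ m)    = toCall ∷ ds , _ , m , f

  walkEncoding : ∀ M d → Encoding (Fin (suc M) × Vec Dir d)
  walkEncoding M d = ×-encoding (finEncoding (suc M)) (vecEncoding dirEncoding d)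

  reach-bounded : ∀ M d (I : Fin (suc (size (walkEncoding M d))) → ℕ) → (∀ {t t′} → t <ᶠ t′ → I t < I t′) →
                  ¬ (∀ t → Σ ℕ λ p → p ≤ M × Within A W d p (I t))
  reach-bounded M d I increasing near with pigeonhole (n<1+n _) code
    where
      code : Fin (suc (size (walkEncoding M d))) → Fin (size (walkEncoding M d))
      code t = let (p , p≤M , w) = near t in encode (walkEncoding M d) (fromℕ< (s≤s p≤M) , proj₁ (within⇒follows w))
  ... | t , t′ , t<t′ , same = <-irrefl (sameEnd (near t) (near t′) (encode-injective (walkEncoding M d) same)) (increasing t<t′)
    where
      sameEnd : ∀ {b b′} ((p , p≤M , w) : Σ ℕ λ p → p ≤ M × Within A W d p b) ((p′ , p′≤M , w′) : Σ ℕ λ p → p ≤ M × Within A W d p b′) →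
                (fromℕ< (s≤s p≤M) , proj₁ (within⇒follows w)) ≡ (fromℕ< (s≤s p′≤M) , proj₁ (within⇒follows w′)) → b ≡ b′
      sameEnd (p , p≤M , w) (p′ , p′≤M , w′) e
        with refl ← trans (sym (toℕ-fromℕ< (s≤s p≤M))) (trans (cong (λ z → toℕ (proj₁ z)) e) (toℕ-fromℕ< (s≤s p′≤M)))
        with within⇒follows w | within⇒follows w′ | cong proj₂ e
      ... | ds , f | .ds , f′ | refl = Follows-deterministic ds f f′

does-true : ∀ {P : Set} (P? : Dec P) → does P? ≡ true → P
does-true (yes p) _ = p

lookup-extensionality : ∀ {X : Set} {k} (xs ys : Vec X k) → (∀ j → lookup xs j ≡ lookup ys j) → xs ≡ ys
lookup-extensionality xs ys pointwise =
  trans (sym (Vec.tabulate∘lookup xs)) (trans (Vec.tabulate-cong pointwise) (Vec.tabulate∘lookup ys))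

-- Copy k lies in the block after the last position of copy k - 1 and is not
-- reached by matching edges from before that block.
module Completeness (A : Alphabet) (r m : ℕ) (V : Fin (suc m) → Sym A) (v : Fin (suc m)) (g : ℕ → Sym A)
                    (spheres : InfinitelyOften A (λ i → SphIso A r (infNW A g) i (finNW A V) v)) where
  open Automaton A r m V v
  open Walks A g

  Copy : Set
  Copy = Σ ℕ λ i → SphIso A r W i S v

  module C (c : Copy) = Embedding A r m V v g (proj₂ c)

  copies : ℕ → Copy
  copies zero    = let (i , _ , iso) = spheres 0 in i , iso
  copies (suc t) = let (i , _ , iso) = spheres (suc (proj₁ (copies t))) in i , iso

  copies-increasing : ∀ {t t′} → t < t′ → proj₁ (copies t) < proj₁ (copies t′)
  copies-increasing {t} {suc t′} (s≤s t≤t′) with m≤n⇒m<n∨m≡n t≤t′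
  ... | inj₁ t<t′ = <-trans (copies-increasing t<t′) (proj₁ (proj₂ (spheres (suc (proj₁ (copies t′))))))
  ... | inj₂ refl = proj₁ (proj₂ (spheres (suc (proj₁ (copies t)))))

  -- opaque so that conversion checking never unfolds the choice of copies
  opaque
    -- Among the first K + 1 copies, K bounding the positions within distance
    -- r + 1 of 0 … M + 1, some copy is not near M.
    farCopy : ∀ M → Σ Copy λ c → ¬ C.Near c M
    farCopy M with any? {n = suc (size (walkEncoding (suc M) (suc r)))} (λ t → ¬? (C.near? (copies (toℕ t)) M))
    ... | yes (t , far) = copies (toℕ t) , far
    ... | no none = ⊥-elim (reach-bounded (suc M) (suc r) (λ t → proj₁ (copies (toℕ t))) copies-increasing
                      λ t → C.near⇒walk (copies (toℕ t)) (decidable-stable (C.near? (copies (toℕ t)) M) (λ far → none (t , far))))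

  opaque
    boundary : ℕ → ℕ
    copy : ℕ → Copy

    boundary zero    = 0
    boundary (suc k) = C.top (copy k)

    copy k = proj₁ (farCopy (boundary k))

    boundary-suc : ∀ k → boundary (suc k) ≡ C.top (copy k)
    boundary-suc k = refl

    copy-far : ∀ k → ¬ C.Near (copy k) (boundary k)
    copy-far k = proj₂ (farCopy (boundary k))

    boundary-zero : boundary 0 ≡ 0
    boundary-zero = refl

  module K (k : ℕ) = C (copy k)

  after-boundary : ∀ k {q} → K.InSphere k q → suc (boundary k) < q
  after-boundary k = K.far-positions k (copy-far k)

  calls-after-boundary : ∀ k {q x} → K.InSphere k q → Match A g x q → boundary k < x
  calls-after-boundary k = K.far-calls k (copy-far k)

  ≤-boundary : ∀ k {q} → K.InSphere k q → q ≤ boundary (suc k)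
  ≤-boundary k {q} w = subst (q ≤_) (sym (boundary-suc k)) (K.≤-top k w)

  boundary-step : ∀ k → suc (boundary k) < boundary (suc k)
  boundary-step k = subst (suc (boundary k) <_) (sym (boundary-suc k)) (after-boundary k (K.top-inSphere k))

  boundary-≥ : ∀ k → k ≤ boundary k
  boundary-≥ zero    = z≤n
  boundary-≥ (suc k) = ≤-trans (s≤s (boundary-≥ k)) (<⇒≤ (boundary-step k))

  boundary-mono : ∀ {k k′} → k < k′ → boundary (suc k) ≤ boundary k′
  boundary-mono {k} {suc k′} (s≤s k≤k′) with m≤n⇒m<n∨m≡n k≤k′
  ... | inj₁ k<k′ = ≤-trans (boundary-mono k<k′) (<⇒≤ (<-trans (n<1+n _) (boundary-step k′)))
  ... | inj₂ refl = ≤-refl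

  Block : ℕ → ℕ → Set
  Block b p = boundary b < p × p ≤ boundary (suc b)

  block-of : ∀ p → 0 < p → Σ ℕ λ b → Block b p
  block-of p 0<p with least (λ k → p ≤? boundary k) p (boundary-≥ p)
  ... | zero  , _ , p≤0 , _ = contradiction (≤-trans 0<p (subst (p ≤_) boundary-zero p≤0)) λ ()
  ... | suc b , _ , p≤ , minimal = b , ≰⇒> (minimal b ≤-refl) , p≤

  block-unique : ∀ {b b′ p} → Block b p → Block b′ p → b ≡ b′
  block-unique {b} {b′} (l , u) (l′ , u′) with <-cmp b b′
  ... | tri< b<b′ _ _ = contradiction (<-≤-trans (≤-<-trans (boundary-mono b<b′) l′) u) (<-irrefl refl)
  ... | tri≈ _ e _    = e
  ... | tri> _ _ b′<b = contradiction (<-≤-trans (≤-<-trans (boundary-mono b′<b) l) u′) (<-irrefl refl)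

  sphere⊆block : ∀ k {q} → K.InSphere k q → Block k q
  sphere⊆block k w = <-trans (n<1+n _) (after-boundary k w) , ≤-boundary k w

  guessIn : ℕ → ℕ → Guess
  guessIn k p with K.inSphere? k p
  ... | yes _ = just (K.to k p)
  ... | no _  = nothing

  guessIn-inside : ∀ {k p} → K.InSphere k p → guessIn k p ≡ just (K.to k p)
  guessIn-inside {k} {p} w with K.inSphere? k p
  ... | yes _ = refl
  ... | no ¬w = contradiction w ¬w

  guessIn-outside : ∀ {k p} → ¬ K.InSphere k p → guessIn k p ≡ nothing
  guessIn-outside {k} {p} ¬w with K.inSphere? k p
  ... | yes w = contradiction w ¬w
  ... | no _  = refl

  usedIn : ℕ → ℕ → Used
  usedIn k p = tabulate λ j → does (ball? j ×-dec (K.from k j ≤? p))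

  lookup-usedIn : ∀ k p j → lookup (usedIn k p) j ≡ does (ball? j ×-dec (K.from k j ≤? p))
  lookup-usedIn k p j = Vec.lookup∘tabulate (λ j → does (ball? j ×-dec (K.from k j ≤? p))) j

  guessIn-next : ∀ k p → NextCompatible (guessIn k p) (guessIn k (suc p))
  guessIn-next k p with K.inSphere? k p | K.inSphere? k (suc p)
  ... | yes w | yes w′ = K.inside-⋖ k w w′
  ... | yes w | no ¬w′ = K.leaving-⋖ k w ¬w′
  ... | no ¬w | yes w′ = K.entering-⋖ k ¬w w′
  ... | no _  | no _   = tt

  usedIn-incomplete : ∀ {k p} → p < boundary (suc k) → ¬ Complete (usedIn k p)
  usedIn-incomplete {k} {p} p<top complete = <-irrefl refl (<-≤-trans p<top (subst (_≤ p) (sym (boundary-suc k)) top≤p))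
    where
      w = K.top-inSphere k
      j = K.to k (K.top k)
      top≤p : K.top k ≤ p
      top≤p = subst (_≤ p) (K.from-to k w)
                (proj₂ (does-true (ball? j ×-dec (K.from k j ≤? p)) (trans (sym (lookup-usedIn k p j)) (complete j (K.to-ball k w)))))

  usedIn-complete : ∀ k → Complete (usedIn k (boundary (suc k)))
  usedIn-complete k j bj = trans (lookup-usedIn k _ j) (dec-true (ball? j ×-dec (K.from k j ≤? _)) (bj , ≤-boundary k (K.from-sphere k bj)))

  usedIn-start : ∀ k → usedIn k (suc (boundary k)) ≡ unused
  usedIn-start k = lookup-extensionality _ _ λ j →
    trans (lookup-usedIn k _ j) (trans (dec-false (ball? j ×-dec (K.from k j ≤? _)) before) (sym (lookup-unused j)))
    where
      before : ∀ {j} → ¬ (Ball j × K.from k j ≤ suc (boundary k))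
      before (bj , le) = <-irrefl refl (<-≤-trans (after-boundary k (K.from-sphere k bj)) le)

  usedIn-same : ∀ k p j → (Ball j → K.from k j ≢ suc p) → lookup (usedIn k (suc p)) j ≡ lookup (usedIn k p) j
  usedIn-same k p j ≢p+1 =
    trans (lookup-usedIn k (suc p) j)
          (trans (does-⇔ (mk⇔ (λ (bj , le) → bj , ≤-pred (≤∧≢⇒< le (≢p+1 bj))) (λ (bj , le) → bj , m≤n⇒m≤1+n le))
                         (ball? j ×-dec (K.from k j ≤? suc p)) (ball? j ×-dec (K.from k j ≤? p)))
                 (sym (lookup-usedIn k p j)))

  usedIn-step : ∀ k p → usedIn k (suc p) ≡ mark (usedIn k p) (guessIn k (suc p))
  usedIn-step k p with K.inSphere? k (suc p)
  ... | no ¬w = lookup-extensionality _ _ λ j → usedIn-same k p j λ bj e → ¬w (subst (K.InSphere k) e (K.from-sphere k bj))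
  ... | yes w = lookup-extensionality _ _ pointwise
    where
      pointwise : ∀ j → lookup (usedIn k (suc p)) j ≡ lookup (mark (usedIn k p) (just (K.to k (suc p)))) j
      pointwise j with K.to k (suc p) ≟ᶠ j
      ... | yes refl = trans (lookup-usedIn k _ j)
                             (trans (dec-true (ball? j ×-dec (K.from k j ≤? suc p)) (K.to-ball k w , ≤-reflexive (K.from-to k w)))
                                    (sym (lookup-mark-self (usedIn k p) j)))
      ... | no ≢j = trans (usedIn-same k p j λ bj e → ≢j (trans (cong (K.to k) (sym e)) (K.to-from k bj)))
                          (sym (lookup-mark-other (usedIn k p) ≢j))

  stateIn : ℕ → ℕ → State
  stateIn k p = guessIn k p , usedIn k p

  σ : ℕ → State
  σ zero    = start
  σ (suc p) = stateIn (proj₁ (block-of (suc p) (s≤s z≤n))) (suc p)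

  σ-in-block : ∀ {b p} → Block b p → σ p ≡ stateIn b p
  σ-in-block {b} {suc p} block = cong (λ b′ → stateIn b′ (suc p)) (block-unique (proj₂ (block-of (suc p) (s≤s z≤n))) block)

  guess : ℕ → Guess
  guess p = proj₁ (σ p)

  GuessCases : ℕ → Set
  GuessCases q = (Σ ℕ λ b → K.InSphere b q × guess q ≡ just (K.to b q)) ⊎ ((∀ b → ¬ K.InSphere b q) × guess q ≡ nothing)

  guess-cases : ∀ q → GuessCases q
  guess-cases zero = inj₂ ((λ b w → contradiction (proj₁ (sphere⊆block b w)) λ ()) , refl)
  guess-cases (suc q) = let (b , block) = block-of (suc q) (s≤s z≤n) in byCases b block (K.inSphere? b (suc q))
    where
      byCases : ∀ b → Block b (suc q) → Dec (K.InSphere b (suc q)) → GuessCases (suc q)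
      byCases b block (yes w) = inj₁ (b , w , trans (cong proj₁ (σ-in-block block)) (guessIn-inside w))
      byCases b block (no ¬w) =
        inj₂ ( (λ b′ w′ → ¬w (subst (λ b → K.InSphere b (suc q)) (block-unique (sphere⊆block b′ w′) block) w′))
             , trans (cong proj₁ (σ-in-block block)) (guessIn-outside ¬w))

  guess-match : ∀ {x y} → Match A g x y → MatchCompatible (guess x) (guess y)
  guess-match {x} {y} m = byCases (guess-cases x) (guess-cases y)
    where
      byCases : GuessCases x → GuessCases y → MatchCompatible (guess x) (guess y)
      byCases (inj₁ (a , wx , gx)) (inj₁ (b , wy , gy))
        with refl ← block-unique (sphere⊆block a wx)
                                 (calls-after-boundary b wy m , ≤-trans (<⇒≤ (proj₁ (proj₂ m))) (≤-boundary b wy))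
        = subst₂ MatchCompatible (sym gx) (sym gy) (K.inside-↝ a wx wy m)
      byCases (inj₁ (a , wx , gx)) (inj₂ (out , gy)) = subst₂ MatchCompatible (sym gx) (sym gy) (K.leaving-↝ a wx (out a) m)
      byCases (inj₂ (out , gx)) (inj₁ (b , wy , gy)) = subst₂ MatchCompatible (sym gx) (sym gy) (K.entering-↝ b (out b) wy m)
      byCases (inj₂ (_ , gx))   (inj₂ (_ , gy))      = subst₂ MatchCompatible (sym gx) (sym gy) tt

  guess-noCall : ∀ {y} → (∀ x → ¬ Match A g x y) → NoCallInBall (guess y)
  guess-noCall {y} ¬m = byCases (guess-cases y)
    where
      byCases : GuessCases y → NoCallInBall (guess y)
      byCases (inj₁ (b , wy , gy)) = subst NoCallInBall (sym gy) λ (k , bk , k↝y) → ¬m _ (K.call-of b wy bk k↝y)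
      byCases (inj₂ (_ , gy))      = subst NoCallInBall (sym gy) tt

  guess-return : ∀ x → MustReturn (guess x) → Σ ℕ λ y → Match A g x y
  guess-return x mr = byCases (guess-cases x)
    where
      byCases : GuessCases x → Σ ℕ λ y → Match A g x y
      byCases (inj₁ (b , wx , gx)) = let (k , bk , x↝k) = subst MustReturn gx mr in _ , K.return-of b wx bk x↝k
      byCases (inj₂ (_ , gx))      = ⊥-elim (subst MustReturn gx mr)

  step-inside : ∀ {b p} → boundary b < p → suc p ≤ boundary (suc b) → Step (stateIn b p) (g (suc p)) (stateIn b (suc p))
  step-inside {b} {p} lo hi = fits (K.inSphere? b (suc p)) , used , (λ c → contradiction c incomplete) , guessIn-next b p
    where
      incomplete : ¬ Complete (usedIn b p)
      incomplete = usedIn-incomplete hi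
      fits : Dec (K.InSphere b (suc p)) → Fits (usedIn b p) (g (suc p)) (guessIn b (suc p))
      fits (no ¬w) = subst (Fits _ _) (sym (guessIn-outside ¬w)) tt
      fits (yes w) = subst (Fits _ _) (sym (guessIn-inside w))
        ( K.to-label b w , K.to-ball b w
        , trans (cong (λ u → lookup u (K.to b (suc p))) (restart-incomplete incomplete))
                (trans (lookup-usedIn b p _) (dec-false (ball? _ ×-dec (K.from b _ ≤? p))
                                                        λ (_ , le) → <-irrefl refl (subst (_≤ p) (K.from-to b w) le))))
      used : usedIn b (suc p) ≡ mark (restart (usedIn b p)) (guessIn b (suc p))
      used = trans (usedIn-step b p) (cong (λ u → mark u (guessIn b (suc p))) (sym (restart-incomplete incomplete)))

  step-to-start : ∀ {l u a} → restart u ≡ unused → NextCompatible l nothing → Step (l , u) a (nothing , unused)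
  step-to-start restarted last = tt , sym restarted , (λ _ → refl) , last

  σ-at-top : ∀ b → σ (boundary (suc b)) ≡ stateIn b (boundary (suc b))
  σ-at-top b = σ-in-block (<-trans (n<1+n _) (boundary-step b) , ≤-refl)

  step-from-boundary : ∀ b → Step (σ (boundary b)) (g (suc (boundary b))) (nothing , unused)
  step-from-boundary zero =
    subst (λ p → Step (σ p) (g (suc p)) (nothing , unused)) (sym boundary-zero)
          (step-to-start {nothing} {unused} {g 1} (restart-incomplete unused-incomplete) tt)
  step-from-boundary (suc b) =
    subst (λ q → Step q (g (suc top)) (nothing , unused)) (sym (σ-at-top b))
          (step-to-start {guessIn b top} {usedIn b top} {g (suc top)} (restart-complete (usedIn-complete b))
                         (subst (λ l → NextCompatible l nothing) (sym (guessIn-inside top-in)) (K.leaving-⋖ b top-in beyond)))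
    where
      top = boundary (suc b)
      top-in : K.InSphere b top
      top-in = subst (K.InSphere b) (sym (boundary-suc b)) (K.top-inSphere b)
      beyond : ¬ K.InSphere b (suc top)
      beyond w = <-irrefl refl (≤-boundary b w)

  stateIn-start : ∀ b → stateIn b (suc (boundary b)) ≡ (nothing , unused)
  stateIn-start b = cong₂ _,_ (guessIn-outside λ w → <-irrefl refl (after-boundary b w)) (usedIn-start b)

  step-everywhere : ∀ p → Step (σ p) (g (suc p)) (σ (suc p))
  step-everywhere p = let (b , lo , hi) = block-of (suc p) (s≤s z≤n)
                      in subst (Step (σ p) (g (suc p))) (sym (σ-in-block (lo , hi))) (inBlock b lo hi (m≤n⇒m<n∨m≡n (≤-pred lo)))
    where
      inBlock : ∀ b → boundary b < suc p → suc p ≤ boundary (suc b) → boundary b < p ⊎ boundary b ≡ p →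
                Step (σ p) (g (suc p)) (stateIn b (suc p))
      inBlock b lo hi (inj₁ inside) = subst (λ q → Step q (g (suc p)) (stateIn b (suc p))) (sym (σ-in-block (inside , <⇒≤ hi)))
                                            (step-inside inside hi)
      inBlock b lo hi (inj₂ refl) = subst (Step (σ (boundary b)) (g (suc (boundary b)))) (sym (stateIn-start b))
                                          (step-from-boundary b)

  accepting : Accepting g σ
  accepting = record
    { step-start     = step-to-start {nothing} {unused} {g 0} (restart-incomplete unused-incomplete) tt , tt
    ; step-matched   = λ p i m → step-everywhere p , guess-match m
    ; step-unmatched = λ p ¬m → step-everywhere p , guess-noCall ¬m
    ; returns        = guess-return
    ; completions    = λ k → boundary (suc k) , ≤-trans (n≤1+n k) (boundary-≥ (suc k))
                           , subst (λ q → Complete (proj₂ q)) (sym (σ-at-top k)) (usedIn-complete k)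
    }

lemma6p8 : (A : Alphabet) (r : ℕ) (m : ℕ) (V : Fin (suc m) → Sym A) (v : Fin (suc m)) →
    Σ (GBA A) λ B → (W : ℕ → Sym A) →
      (Accepts A B W ⇔ InfinitelyOften A (λ i → SphIso A r (infNW A W) i (finNW A V) v))
lemma6p8 A r m V v = automaton , λ W → mk⇔ (sound W) (complete W)
  where
    open Automaton A r m V v
    sound : ∀ W → Accepts A automaton W → InfinitelyOften A (λ i → SphIso A r (infNW A W) i S v)
    sound W accepts = Soundness.Run.spheres A r m V v W (proj₂ (accepts⇒accepting accepts))
    complete : ∀ W → InfinitelyOften A (λ i → SphIso A r (infNW A W) i S v) → Accepts A automaton W
    complete W spheres = accepting⇒accepts (Completeness.accepting A r m V v W spheres)
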